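{- Let $Z$ be a non-degenerate multimatroid and let $\prec$ be a total ordering of its skew classes. Then \[ Q(Z;t)= \sum_{[B]\in \mathcal B(Z)/\sim }\ \prod_{\omega \in \mathrm{act}_{\prec}(B)} (t+|\omega|-1),\] where the sum is over the equivalence classes of $\sim$ on the set $\mathcal B(Z)$ of bases, and the product is over the active skew classes of any representative $B$ of the class.
   Context: A carrier is a pair $(U,\Omega)$, $U$ finite, $\Omega$ a partition of $U$ into non-empty skew classes; subtransversals meet each skew class at most once, transversals exactly once; skew pair: two distinct elements of a skew class. A multimatroid $Z=(U,\Omega,r)$ has a non-negative integer $r$ on subtransversals with (R1) on each transversal $r$ is a matroid rank function; (R2) for subtransversal $S$ and skew pair $\{x,y\}$ in a skew class disjoint from $S$, $r(S\cup\{x\})+r(S\cup\{y\})-2r(S)\ge1$. $n(S)=|S|-r(S)$. Bases: maximal subtransversals with $n=0$; circuits: minimal subtransversals with $n>0$. Non-degenerate: all skew classes have size $\ge2$. $S_\omega$ is the element of $S\cap\omega$. For basis $B$ and skew class $\omega$, $B\cup\omega$ contains at most one circuit $C(B,\omega)$. $\prec$ induces an order on any subtransversal with least element $\min$. $\omega$ is active w.r.t. $B$ if $C(B,\omega)$ exists and $\min C(B,\omega)\in\omega$; $\mathrm{act}_\prec(B)$ is the set of active classes, the rest are inactive. $B\sim B'$ if they have the same active skew classes and $B_\omega=B'_\omega$ for every inactive $\omega$. The unweighted transition polynomial is $Q(Z;t)=\sum_T t^{n(T)}$ over all transversals $T$. -}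

module Defs where

open import Level using (0ℓ)
open import Data.Nat using (ℕ; _+_; _*_; _∸_; _^_; _≤_; _<_)
import Data.Nat as ℕ
open import Data.Fin using (Fin)
import Data.Fin as F
open import Data.Fin.Properties using (all?; any?)
open import Data.Fin.Subset using (Subset; _∈_; _∉_; _⊆_; _⊂_; _∪_; _∩_; ∣_∣; ⁅_⁆; inside; outside)
open import Data.Fin.Subset.Properties using (anySubset?; _∈?_; _⊆?_; _⊂?_)
open import Data.Vec using ([]; _∷_; tabulate)
open import Data.List using (List; []; _∷_; _++_; map; filter; allFin)
open import Data.Nat.ListAction using (sum; product)
open import Data.List.Relation.Unary.All using (All)
open import Data.List.Relation.Unary.Any using (Any)
open import Data.List.Relation.Unary.AllPairs using (AllPairs)
open import Data.Product using (Σ; ∃; _×_; _,_; proj₁)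
open import Relation.Binary using (Rel)
open import Relation.Binary.Structures using (IsStrictTotalOrder)
open import Relation.Binary.PropositionalEquality using (_≡_; _≢_)
open import Relation.Nullary using (¬_; Dec; ¬?; ⌊_⌋)
open import Relation.Nullary.Decidable using (_×-dec_; _→-dec_)

-- Carrier: U = Fin n, skew classes indexed by Fin m, σ x = skew class of x.

classOf : ∀ {n m} → (Fin n → Fin m) → Fin m → Subset n
classOf σ ω = tabulate (λ x → ⌊ σ x F.≟ ω ⌋)

classSize : ∀ {n m} → (Fin n → Fin m) → Fin m → ℕ
classSize σ ω = ∣ classOf σ ω ∣

IsSubtransversal : ∀ {n m} → (Fin n → Fin m) → Subset n → Set
IsSubtransversal σ S = ∀ x y → x ∈ S → y ∈ S → σ x ≡ σ y → x ≡ y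

IsTransversal : ∀ {n m} → (Fin n → Fin m) → Subset n → Set
IsTransversal σ S = IsSubtransversal σ S × (∀ ω → ∃ λ x → x ∈ S × σ x ≡ ω)

IsMatroidRankOn : ∀ {n} → (Subset n → ℕ) → Subset n → Set
IsMatroidRankOn r T =
  (∀ X → X ⊆ T → r X ≤ ∣ X ∣) ×
  (∀ X Y → X ⊆ Y → Y ⊆ T → r X ≤ r Y) ×
  (∀ X Y → X ⊆ T → Y ⊆ T → r (X ∪ Y) + r (X ∩ Y) ≤ r X + r Y)

record Multimatroid (n m : ℕ) : Set where
  field
    σ      : Fin n → Fin m
    σ-surj : ∀ ω → ∃ λ x → σ x ≡ ω
    -- rank; only its values on subtransversals matter
    r      : Subset n → ℕ
    R1     : ∀ T → IsTransversal σ T → IsMatroidRankOn r T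
    R2     : ∀ S x y → IsSubtransversal σ S → x ≢ y → σ x ≡ σ y →
             (∀ z → z ∈ S → σ z ≢ σ x) →
             1 + 2 * r S ≤ r (S ∪ ⁅ x ⁆) + r (S ∪ ⁅ y ⁆)

open Multimatroid public

module _ {n m : ℕ} (Z : Multimatroid n m) where

  nullity : Subset n → ℕ
  nullity S = ∣ S ∣ ∸ r Z S

  NonDegenerate : Set
  NonDegenerate = ∀ ω → 2 ≤ classSize (σ Z) ω

  IsBasis : Subset n → Set
  IsBasis B = IsSubtransversal (σ Z) B × nullity B ≡ 0 ×
              (∀ S → IsSubtransversal (σ Z) S → B ⊆ S → nullity S ≡ 0 → S ⊆ B)

  IsCircuit : Subset n → Set
  IsCircuit C = IsSubtransversal (σ Z) C × 0 < nullity C ×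
                ¬ (∃ λ D → D ⊂ C × 0 < nullity D)

  module _ (_≺_ : Rel (Fin m) 0ℓ) where

    MinIn : Subset n → Fin m → Set
    MinIn C ω = ∃ λ x → x ∈ C × σ Z x ≡ ω ×
                  (∀ y → y ∈ C → y ≢ x → ω ≺ σ Z y)

    -- ω is active w.r.t. B: the (unique) circuit C(B,ω) ⊆ B ∪ ω exists
    -- and its minimum lies in ω
    Active : Subset n → Fin m → Set
    Active B ω = ∃ λ C → IsCircuit C × C ⊆ (B ∪ classOf (σ Z) ω) × MinIn C ω

    _~_ : Subset n → Subset n → Set
    B ~ B' = (∀ ω → (Active B ω → Active B' ω) × (Active B' ω → Active B ω)) ×
             (∀ ω → ¬ Active B ω → ∀ x → σ Z x ≡ ω →
                (x ∈ B → x ∈ B') × (x ∈ B' → x ∈ B))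

    IsRepSystem : List (Subset n) → Set
    IsRepSystem Rs = All IsBasis Rs ×
                     (∀ B → IsBasis B → Any (B ~_) Rs) ×
                     AllPairs (λ B B' → ¬ (B ~ B')) Rs

allSubsets : (n : ℕ) → List (Subset n)
allSubsets ℕ.zero    = [] ∷ []
allSubsets (ℕ.suc n) = map (inside ∷_) (allSubsets n) ++ map (outside ∷_) (allSubsets n)

subtransversal? : ∀ {n m} (σ : Fin n → Fin m) S → Dec (IsSubtransversal σ S)
subtransversal? σ S = all? λ x → all? λ y →
  (x ∈? S) →-dec ((y ∈? S) →-dec ((σ x F.≟ σ y) →-dec (x F.≟ y)))

transversal? : ∀ {n m} (σ : Fin n → Fin m) S → Dec (IsTransversal σ S)
transversal? σ S = subtransversal? σ S ×-dec
  (all? λ ω → any? λ x → (x ∈? S) ×-dec (σ x F.≟ ω))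

module _ {n m : ℕ} (Z : Multimatroid n m) where

  circuit? : ∀ C → Dec (IsCircuit Z C)
  circuit? C = subtransversal? (σ Z) C ×-dec (0 ℕ.<? nullity Z C) ×-dec
    ¬? (anySubset? λ D → (D ⊂? C) ×-dec (0 ℕ.<? nullity Z D))

  module _ {_≺_ : Rel (Fin m) 0ℓ} (sto : IsStrictTotalOrder _≡_ _≺_) where
    open IsStrictTotalOrder sto using (_<?_)

    minIn? : ∀ C ω → Dec (MinIn Z _≺_ C ω)
    minIn? C ω = any? λ x → (x ∈? C) ×-dec (σ Z x F.≟ ω) ×-dec
      (all? λ y → (y ∈? C) →-dec (¬? (y F.≟ x) →-dec (ω <? σ Z y)))

    active? : ∀ B ω → Dec (Active Z _≺_ B ω)
    active? B ω = anySubset? λ C → circuit? C ×-dec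
      ((C ⊆? (B ∪ classOf (σ Z) ω)) ×-dec minIn? C ω)

    activeClasses : Subset n → List (Fin m)
    activeClasses B = filter (active? B) (allFin m)

    activityWeight : ℕ → Subset n → ℕ
    activityWeight t B = product (map (λ ω → t + classSize (σ Z) ω ∸ 1) (activeClasses B))

  transitionPoly : ℕ → ℕ
  transitionPoly t = sum (map (λ T → t ^ nullity Z T) (filter (transversal? (σ Z)) (allSubsets n)))

{-# OPTIONS --safe #-}
module Submission where

-- For a transversal T and a skew class ω, call ω spanned in T when some element z of ω satisfies
-- r(T′ ∪ z) = r(T′), where T′ is the part of T in the classes above ω. By (R2) such a z is unique, and
-- for a basis, ω is spanned exactly when it is active. Building T from the top class down, n(T) is the
-- number of classes whose element in T is spanned in this sense. Say that T agrees with a basis R when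
-- they coincide on every class not spanned in R. Then, by induction from the top, T and R have the
-- same rank increments over the classes above any given one, hence the same spanned elements. So
-- bases that agree with a common transversal are ~-equivalent, and every transversal agrees with
-- exactly one representative: non-degeneracy lets one turn it into an agreeing basis by trading each
-- spanned element for a skew partner. Summing t^n(T) over the transversals agreeing with R factorises
-- over the classes: an active class gives t for its spanned element plus 1 for each of the other
-- |ω| − 1 elements, and an inactive class gives 1, since T must use the element of R there, which is
-- not spanned.

open import Defs
open import Level using (0ℓ)
open import Data.Bool using (true; false)
import Data.Bool.Properties as Bool
open import Data.Empty using (⊥; ⊥-elim)
open import Data.Fin using (Fin; zero; suc)
import Data.Fin as Fin
open import Data.Fin.Properties using (any?; all?)
import Data.Fin.Properties as Finₚ
open import Data.Fin.Subset using (Subset; _∈_; _∉_; _⊆_; _⊂_; _∪_; _∩_; ∣_∣; ⁅_⁆; ⊤; inside; outside) renaming (⊥ to ∅)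
open import Data.Fin.Subset.Properties
  using (_∈?_; _⊂?_; anySubset?; x∈p∪q⁺; x∈p∪q⁻; x∈p∩q⁺; x∈p∩q⁻; x∈⁅x⁆; x∈⁅y⁆⇒x≡y; ∣⁅x⁆∣≡1; ∉⊥; ∈⊤; ∣⊥∣≡0;
         p⊆p∪q; q⊆p∪q; ∪-assoc; ∪-comm; ⊆-antisym; p⊆q⇒∣p∣≤∣q∣; p⊂q⇒∣p∣<∣q∣; nonempty?; Empty-unique; drop-there)
open import Data.List using (List; []; _∷_; _++_; map; filter; allFin)
import Data.List.Properties as List
open import Data.List.Membership.Propositional using () renaming (_∈_ to _∈ₗ_)
open import Data.List.Membership.Propositional.Properties using (∈-allFin)
open import Data.List.Relation.Unary.All using (All; []; _∷_)
open import Data.List.Relation.Unary.Any using (Any; here; there)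
import Data.List.Relation.Unary.Any as Any
open import Data.List.Relation.Unary.AllPairs using (AllPairs; _∷_)
import Data.List.Relation.Unary.AllPairs as AllPairs
open import Data.Nat using (ℕ; zero; suc; _+_; _*_; _∸_; _^_; _≤_; _<_; z≤n; s≤s)
import Data.Nat as ℕ
open import Data.Nat.Induction using (<-wellFounded)
open import Data.Nat.ListAction using (sum; product)
open import Data.Nat.ListAction.Properties using (sum-++)
open import Data.Nat.Properties hiding (_≟_; _<?_)
open import Algebra.Properties.CommutativeSemigroup +-commutativeSemigroup using () renaming (interchange to +-interchange)
open import Algebra.Properties.CommutativeSemigroup *-commutativeSemigroup using () renaming (interchange to *-interchange)
open import Data.Nat.Solver using (module +-*-Solver)
open +-*-Solver using (solve; _:+_; _:=_)
open import Data.Product using (∃; _×_; _,_; proj₁; proj₂)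
open import Data.Sum using (_⊎_; inj₁; inj₂; [_,_]′)
open import Data.Vec using ([]; _∷_; here; there; tabulate)
import Data.Vec.Properties as Vec
open import Function using (id; _∘_; _∘′_)
open import Induction.WellFounded using (Acc; acc)
open import Relation.Binary using (Rel; DecidableEquality; tri<; tri≈; tri>)
open import Relation.Binary.PropositionalEquality
open import Relation.Binary.Structures using (IsStrictTotalOrder)
open import Relation.Nullary using (¬_; Dec; yes; no; ¬?; ⌊_⌋)
open import Relation.Nullary.Decidable using (_×-dec_; _→-dec_; _⊎-dec_)

χ : {P : Set} → Dec P → ℕ
χ (yes _) = 1
χ (no _)  = 0

χ-yes : {P : Set} (p : Dec P) → P → χ p ≡ 1
χ-yes (yes _) _  = refl
χ-yes (no ¬p) p = ⊥-elim (¬p p)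

χ-no : {P : Set} (p : Dec P) → ¬ P → χ p ≡ 0
χ-no (yes p) ¬p = ⊥-elim (¬p p)
χ-no (no _)  _  = refl

χ-cong : {P Q : Set} (p : Dec P) (q : Dec Q) → (P → Q) → (Q → P) → χ p ≡ χ q
χ-cong (yes _) (yes _) _ _ = refl
χ-cong (yes p) (no ¬q) f _ = ⊥-elim (¬q (f p))
χ-cong (no ¬p) (yes q) _ g = ⊥-elim (¬p (g q))
χ-cong (no _)  (no _)  _ _ = refl

χ-× : {P Q : Set} (p : Dec P) (q : Dec Q) → χ (p ×-dec q) ≡ χ p * χ q
χ-× (yes _) (yes _) = refl
χ-× (yes _) (no _)  = refl
χ-× (no _)  _       = refl

χ*χ-exclusive : {P Q : Set} (p : Dec P) (q : Dec Q) → (P → Q → ⊥) → χ p * χ q ≡ 0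
χ*χ-exclusive (yes p) (yes q) exclusive = ⊥-elim (exclusive p q)
χ*χ-exclusive (yes _) (no _)  _         = refl
χ*χ-exclusive (no _)  _       _         = refl

χ-⊎ : {P Q R : Set} (p : Dec P) (q : Dec Q) (r : Dec R) → (P → Q ⊎ R) → (Q ⊎ R → P) → (Q → R → ⊥) →
      χ p ≡ χ q + χ r
χ-⊎ p (yes q) (yes r) _ _    exclusive = ⊥-elim (exclusive q r)
χ-⊎ p (yes q) (no _)  _ from _         = χ-yes p (from (inj₁ q))
χ-⊎ p (no _)  (yes r) _ from _         = χ-yes p (from (inj₂ r))
χ-⊎ p (no ¬q) (no ¬r) into _ _         = χ-no p ([ ¬q , ¬r ]′ ∘ into)

∑-syntax : {A : Set} → List A → (A → ℕ) → ℕ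
∑-syntax xs f = sum (map f xs)

∏-syntax : {A : Set} → List A → (A → ℕ) → ℕ
∏-syntax xs f = product (map f xs)

infix 5 ∑-syntax ∏-syntax
syntax ∑-syntax xs (λ x → e) = ∑[ x ← xs ] e
syntax ∏-syntax xs (λ x → e) = ∏[ x ← xs ] e

module _ {A : Set} where

  ∑-cong : ∀ xs {f g : A → ℕ} → (∀ x → f x ≡ g x) → ∑[ x ← xs ] f x ≡ ∑[ x ← xs ] g x
  ∑-cong xs f≗g = cong sum (List.map-cong f≗g xs)

  ∏-cong : ∀ xs {f g : A → ℕ} → (∀ x → f x ≡ g x) → ∏[ x ← xs ] f x ≡ ∏[ x ← xs ] g x
  ∏-cong xs f≗g = cong product (List.map-cong f≗g xs)

  ∑-distrib-+ : ∀ xs (f g : A → ℕ) → ∑[ x ← xs ] (f x + g x) ≡ (∑[ x ← xs ] f x) + (∑[ x ← xs ] g x)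
  ∑-distrib-+ []       f g = refl
  ∑-distrib-+ (x ∷ xs) f g =
    trans (cong (f x + g x +_) (∑-distrib-+ xs f g)) (+-interchange (f x) (g x) _ _)

  ∏-distrib-* : ∀ xs (f g : A → ℕ) → ∏[ x ← xs ] (f x * g x) ≡ (∏[ x ← xs ] f x) * (∏[ x ← xs ] g x)
  ∏-distrib-* []       f g = refl
  ∏-distrib-* (x ∷ xs) f g =
    trans (cong (f x * g x *_) (∏-distrib-* xs f g)) (*-interchange (f x) (g x) _ _)

  ∑-distribˡ-* : ∀ xs c (f : A → ℕ) → ∑[ x ← xs ] (c * f x) ≡ c * (∑[ x ← xs ] f x)
  ∑-distribˡ-* []       c f = sym (*-zeroʳ c)
  ∑-distribˡ-* (x ∷ xs) c f =
    trans (cong (c * f x +_) (∑-distribˡ-* xs c f)) (sym (*-distribˡ-+ c (f x) _))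

  ∑-distribʳ-* : ∀ xs (f : A → ℕ) c → ∑[ x ← xs ] (f x * c) ≡ (∑[ x ← xs ] f x) * c
  ∑-distribʳ-* xs f c = trans (∑-cong xs (λ x → *-comm (f x) c)) (trans (∑-distribˡ-* xs c f) (*-comm c _))

  ∑-zero : ∀ xs {f : A → ℕ} → (∀ x → f x ≡ 0) → ∑[ x ← xs ] f x ≡ 0
  ∑-zero []       f≡0 = refl
  ∑-zero (x ∷ xs) f≡0 = cong₂ _+_ (f≡0 x) (∑-zero xs f≡0)

  ∏-one : ∀ xs {f : A → ℕ} → (∀ x → f x ≡ 1) → ∏[ x ← xs ] f x ≡ 1
  ∏-one []       f≡1 = refl
  ∏-one (x ∷ xs) f≡1 = cong₂ _*_ (f≡1 x) (∏-one xs f≡1)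

  ∏-^ : ∀ xs c (g : A → ℕ) → ∏[ x ← xs ] c ^ g x ≡ c ^ (∑[ x ← xs ] g x)
  ∏-^ []       c g = refl
  ∏-^ (x ∷ xs) c g = trans (cong (c ^ g x *_) (∏-^ xs c g)) (sym (^-distribˡ-+-* c (g x) _))

  ∑-filter : {P : A → Set} (P? : ∀ x → Dec (P x)) (f : A → ℕ) (xs : List A) →
             ∑[ x ← filter P? xs ] f x ≡ ∑[ x ← xs ] χ (P? x) * f x
  ∑-filter P? f []       = refl
  ∑-filter P? f (x ∷ xs) with P? x
  ... | yes _ = cong₂ _+_ (sym (+-identityʳ (f x))) (∑-filter P? f xs)
  ... | no _  = ∑-filter P? f xs

  ∏-filter : {P : A → Set} (P? : ∀ x → Dec (P x)) (f : A → ℕ) (xs : List A) →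
             ∏[ x ← filter P? xs ] f x ≡ ∏[ x ← xs ] f x ^ χ (P? x)
  ∏-filter P? f []       = refl
  ∏-filter P? f (x ∷ xs) with P? x
  ... | yes _ = cong₂ _*_ (sym (*-identityʳ (f x))) (∏-filter P? f xs)
  ... | no _  = trans (∏-filter P? f xs) (sym (+-identityʳ _))

  ∑-exactly-one : {P Q : A → Set} (P? : ∀ x → Dec (P x)) {xs : List A} → All Q xs → Any (λ x → Q x → P x) xs →
                  AllPairs (λ x y → Q x → Q y → P x → P y → ⊥) xs → ∑[ x ← xs ] χ (P? x) ≡ 1
  ∑-exactly-one {P} {Q} P? {x ∷ _} (qx ∷ qxs) (here q⇒p) (uniq ∷ _) =
    cong₂ _+_ (χ-yes (P? x) px) (none qxs uniq)
    where
    px : P x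
    px = q⇒p qx
    none : ∀ {ys} → All Q ys → All (λ y → Q x → Q y → P x → P y → ⊥) ys → ∑[ y ← ys ] χ (P? y) ≡ 0
    none []         []       = refl
    none (qy ∷ qys) (u ∷ us) = cong₂ _+_ (χ-no (P? _) (u qx qy px)) (none qys us)
  ∑-exactly-one {P} {Q} P? {x ∷ _} (qx ∷ qxs) (there pxs) (uniq ∷ uniqs) =
    cong₂ _+_ (χ-no (P? x) (clash qxs pxs uniq)) (∑-exactly-one P? qxs pxs uniqs)
    where
    clash : ∀ {ys} → All Q ys → Any (λ y → Q y → P y) ys → All (λ y → Q x → Q y → P x → P y → ⊥) ys → P x → ⊥
    clash (qy ∷ _)   (here q⇒p)  (u ∷ _)  px = u qx qy px (q⇒p qy)
    clash (_ ∷ qys) (there pys) (_ ∷ us) px = clash qys pys us px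

∑-comm : {A B : Set} (xs : List A) (ys : List B) (f : A → B → ℕ) →
         ∑[ x ← xs ] ∑[ y ← ys ] f x y ≡ ∑[ y ← ys ] ∑[ x ← xs ] f x y
∑-comm []       ys f = sym (∑-zero ys (λ _ → refl))
∑-comm (x ∷ xs) ys f = trans (cong ((∑[ y ← ys ] f x y) +_) (∑-comm xs ys f))
                             (sym (∑-distrib-+ ys (f x) (λ y → ∑[ x′ ← xs ] f x′ y)))

∑-cong-All : {A : Set} {P : A → Set} {xs : List A} {f g : A → ℕ} → All P xs → (∀ {x} → P x → f x ≡ g x) →
             ∑[ x ← xs ] f x ≡ ∑[ x ← xs ] g x
∑-cong-All []         _   = refl
∑-cong-All (px ∷ pxs) f≡g = cong₂ _+_ (f≡g px) (∑-cong-All pxs f≡g)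

∑-allFin-suc : ∀ {n} (f : Fin (suc n) → ℕ) →
               ∑[ x ← allFin (suc n) ] f x ≡ f zero + (∑[ x ← allFin n ] f (suc x))
∑-allFin-suc f = cong (f zero +_) (cong sum (trans (List.map-tabulate suc f) (sym (List.map-tabulate id (f ∘ suc)))))

∑-allSubsets-suc : ∀ {n} (f : Subset (suc n) → ℕ) →
                   ∑[ X ← allSubsets (suc n) ] f X ≡
                   (∑[ X ← allSubsets n ] f (inside ∷ X)) + (∑[ X ← allSubsets n ] f (outside ∷ X))
∑-allSubsets-suc {n} f = begin
  sum (map f (map (inside ∷_) Xs ++ map (outside ∷_) Xs))
    ≡⟨ cong sum (List.map-++ f (map (inside ∷_) Xs) _) ⟩
  sum (map f (map (inside ∷_) Xs) ++ map f (map (outside ∷_) Xs))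
    ≡⟨ sum-++ (map f (map (inside ∷_) Xs)) _ ⟩
  sum (map f (map (inside ∷_) Xs)) + sum (map f (map (outside ∷_) Xs))
    ≡⟨ cong₂ _+_ (cong sum (List.map-∘ Xs)) (cong sum (List.map-∘ Xs)) ⟨
  (∑[ X ← Xs ] f (inside ∷ X)) + (∑[ X ← Xs ] f (outside ∷ X)) ∎
  where
  open ≡-Reasoning
  Xs = allSubsets n

module _ {A : Set} (_≟_ : DecidableEquality A) where

  record Enumerates (xs : List A) : Set where
    constructor occurs-once
    field once : ∀ a → ∑[ x ← xs ] χ (x ≟ a) ≡ 1

  module _ {xs : List A} (enum : Enumerates xs) where

    open Enumerates enum

    ∑-supported : ∀ a (f : A → ℕ) → (∀ x → x ≢ a → f x ≡ 0) → ∑[ x ← xs ] f x ≡ f a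
    ∑-supported a f vanish = begin
      ∑[ x ← xs ] f x               ≡⟨ ∑-cong xs f≡fa*δ ⟩
      ∑[ x ← xs ] f a * χ (x ≟ a)   ≡⟨ ∑-distribˡ-* xs (f a) _ ⟩
      f a * (∑[ x ← xs ] χ (x ≟ a)) ≡⟨ cong (f a *_) (once a) ⟩
      f a * 1                       ≡⟨ *-identityʳ (f a) ⟩
      f a                           ∎
      where
      open ≡-Reasoning
      f≡fa*δ : ∀ x → f x ≡ f a * χ (x ≟ a)
      f≡fa*δ x with x ≟ a
      ... | yes refl = sym (*-identityʳ (f x))
      ... | no x≢a   = trans (vanish x x≢a) (sym (*-zeroʳ (f a)))

    ∏-supported : ∀ a (f : A → ℕ) → (∀ x → x ≢ a → f x ≡ 1) → ∏[ x ← xs ] f x ≡ f a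
    ∏-supported a f trivial = begin
      ∏[ x ← xs ] f x               ≡⟨ ∏-cong xs f≡fa^δ ⟩
      ∏[ x ← xs ] f a ^ χ (x ≟ a)   ≡⟨ ∏-^ xs (f a) _ ⟩
      f a ^ (∑[ x ← xs ] χ (x ≟ a)) ≡⟨ cong (f a ^_) (once a) ⟩
      f a ^ 1                       ≡⟨ ^-identityʳ (f a) ⟩
      f a                           ∎
      where
      open ≡-Reasoning
      f≡fa^δ : ∀ x → f x ≡ f a ^ χ (x ≟ a)
      f≡fa^δ x with x ≟ a
      ... | yes refl = sym (^-identityʳ (f x))
      ... | no x≢a   = trivial x x≢a

    ∑-reweight-one : {P : A → Set} (P? : ∀ x → Dec (P x)) {y : A} → P y → ∀ t →
                     (∑[ x ← xs ] χ (P? x) * t ^ χ (x ≟ y)) + 1 ≡ t + (∑[ x ← xs ] χ (P? x))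
    ∑-reweight-one P? {y} py t = begin
      (∑[ x ← xs ] χ (P? x) * t ^ χ (x ≟ y)) + 1
        ≡⟨ cong ((∑[ x ← xs ] χ (P? x) * t ^ χ (x ≟ y)) +_) (once y) ⟨
      (∑[ x ← xs ] χ (P? x) * t ^ χ (x ≟ y)) + (∑[ x ← xs ] χ (x ≟ y))
        ≡⟨ ∑-distrib-+ xs _ _ ⟨
      ∑[ x ← xs ] (χ (P? x) * t ^ χ (x ≟ y) + χ (x ≟ y))
        ≡⟨ ∑-cong xs swap-weight ⟩
      ∑[ x ← xs ] (t * χ (x ≟ y) + χ (P? x))
        ≡⟨ ∑-distrib-+ xs _ _ ⟩
      (∑[ x ← xs ] t * χ (x ≟ y)) + (∑[ x ← xs ] χ (P? x))
        ≡⟨ cong (_+ (∑[ x ← xs ] χ (P? x))) (∑-supported y (λ x → t * χ (x ≟ y)) vanish) ⟩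
      t * χ (y ≟ y) + (∑[ x ← xs ] χ (P? x))
        ≡⟨ cong (λ k → t * k + (∑[ x ← xs ] χ (P? x))) (χ-yes (y ≟ y) refl) ⟩
      t * 1 + (∑[ x ← xs ] χ (P? x))
        ≡⟨ cong (_+ (∑[ x ← xs ] χ (P? x))) (*-identityʳ t) ⟩
      t + (∑[ x ← xs ] χ (P? x)) ∎
      where
      open ≡-Reasoning
      swap-weight : ∀ x → χ (P? x) * t ^ χ (x ≟ y) + χ (x ≟ y) ≡ t * χ (x ≟ y) + χ (P? x)
      swap-weight x with x ≟ y
      ... | yes refl rewrite χ-yes (P? x) py = cong (_+ 1) (*-identityˡ (t * 1))
      ... | no _     = begin
        χ (P? x) * 1 + 0 ≡⟨ +-identityʳ _ ⟩
        χ (P? x) * 1     ≡⟨ *-identityʳ _ ⟩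
        χ (P? x)         ≡⟨ cong (_+ χ (P? x)) (*-zeroʳ t) ⟨
        t * 0 + χ (P? x) ∎
      vanish : ∀ x → x ≢ y → t * χ (x ≟ y) ≡ 0
      vanish x x≢y = trans (cong (t *_) (χ-no (x ≟ y) x≢y)) (*-zeroʳ t)

    ∑-reindex : {B C : Set} (bs : List B) (cs : List C) (h : B → C → A) (v : B → C → ℕ) (w : A → ℕ) →
                (∀ a → w a ≡ ∑[ b ← bs ] ∑[ c ← cs ] v b c * χ (a ≟ h b c)) →
                (F : A → ℕ) → ∑[ a ← xs ] w a * F a ≡ ∑[ b ← bs ] ∑[ c ← cs ] v b c * F (h b c)
    ∑-reindex bs cs h v w multiplicity F = begin
      ∑[ a ← xs ] w a * F a
        ≡⟨ ∑-cong xs (λ a → trans (*-comm (w a) (F a)) (cong (F a *_) (multiplicity a))) ⟩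
      ∑[ a ← xs ] F a * (∑[ b ← bs ] ∑[ c ← cs ] v b c * χ (a ≟ h b c))
        ≡⟨ ∑-cong xs (λ a → trans (sym (∑-distribˡ-* bs (F a) _))
                                  (∑-cong bs (λ b → sym (∑-distribˡ-* cs (F a) _)))) ⟩
      ∑[ a ← xs ] ∑[ b ← bs ] ∑[ c ← cs ] F a * (v b c * χ (a ≟ h b c))
        ≡⟨ ∑-comm xs bs _ ⟩
      ∑[ b ← bs ] ∑[ a ← xs ] ∑[ c ← cs ] F a * (v b c * χ (a ≟ h b c))
        ≡⟨ ∑-cong bs (λ b → ∑-comm xs cs _) ⟩
      ∑[ b ← bs ] ∑[ c ← cs ] ∑[ a ← xs ] F a * (v b c * χ (a ≟ h b c))
        ≡⟨ ∑-cong bs (λ b → ∑-cong cs (λ c → pick-out b c)) ⟩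
      ∑[ b ← bs ] ∑[ c ← cs ] v b c * F (h b c) ∎
      where
      open ≡-Reasoning
      pick-out : ∀ b c → ∑[ a ← xs ] F a * (v b c * χ (a ≟ h b c)) ≡ v b c * F (h b c)
      pick-out b c = begin
        ∑[ a ← xs ] F a * (v b c * χ (a ≟ h b c))
          ≡⟨ ∑-supported (h b c) (λ a → F a * (v b c * χ (a ≟ h b c))) vanish ⟩
        F (h b c) * (v b c * χ (h b c ≟ h b c))
          ≡⟨ cong (λ k → F (h b c) * (v b c * k)) (χ-yes (h b c ≟ h b c) refl) ⟩
        F (h b c) * (v b c * 1)
          ≡⟨ trans (cong (F (h b c) *_) (*-identityʳ (v b c))) (*-comm (F (h b c)) (v b c)) ⟩
        v b c * F (h b c) ∎
        where
        vanish : ∀ a → a ≢ h b c → F a * (v b c * χ (a ≟ h b c)) ≡ 0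
        vanish a a≢hbc rewrite χ-no (a ≟ h b c) a≢hbc | *-zeroʳ (v b c) = *-zeroʳ (F a)

allFin-once : ∀ n a → ∑[ x ← allFin n ] χ (x Fin.≟ a) ≡ 1
allFin-once (suc n) zero = begin
  ∑[ x ← allFin (suc n) ] χ (x Fin.≟ zero)           ≡⟨ ∑-allFin-suc {n} (λ x → χ (x Fin.≟ zero)) ⟩
  1 + (∑[ x ← allFin n ] χ (suc x Fin.≟ zero))       ≡⟨ cong suc (∑-zero (allFin n) (λ x → χ-no (suc x Fin.≟ zero) (λ ()))) ⟩
  1                                                  ∎
  where open ≡-Reasoning
allFin-once (suc n) (suc a) = begin
  ∑[ x ← allFin (suc n) ] χ (x Fin.≟ suc a)          ≡⟨ ∑-allFin-suc {n} (λ x → χ (x Fin.≟ suc a)) ⟩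
  0 + (∑[ x ← allFin n ] χ (suc x Fin.≟ suc a))      ≡⟨ ∑-cong (allFin n) (λ x →
                                                          χ-cong (suc x Fin.≟ suc a) (x Fin.≟ a) Finₚ.suc-injective (cong suc)) ⟩
  ∑[ x ← allFin n ] χ (x Fin.≟ a)                    ≡⟨ allFin-once n a ⟩
  1                                                  ∎
  where open ≡-Reasoning

allFin-enumerates : ∀ n → Enumerates Fin._≟_ (allFin n)
allFin-enumerates n = occurs-once (allFin-once n)

_≟ˢ_ : ∀ {n} → DecidableEquality (Subset n)
_≟ˢ_ = Vec.≡-dec Bool._≟_

χ-∷-≟ : ∀ {n} b c (X S : Subset n) → χ ((b ∷ X) ≟ˢ (c ∷ S)) ≡ χ (b Bool.≟ c) * χ (X ≟ˢ S)
χ-∷-≟ b c X S = trans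
  (χ-cong ((b ∷ X) ≟ˢ (c ∷ S)) ((b Bool.≟ c) ×-dec (X ≟ˢ S)) Vec.∷-injective (λ (b≡c , X≡S) → cong₂ _∷_ b≡c X≡S))
  (χ-× (b Bool.≟ c) (X ≟ˢ S))

allSubsets-once : ∀ n S → ∑[ X ← allSubsets n ] χ (X ≟ˢ S) ≡ 1
allSubsets-once zero    []      = refl
allSubsets-once (suc n) (c ∷ S) = begin
  ∑[ X ← allSubsets (suc n) ] χ (X ≟ˢ (c ∷ S))
    ≡⟨ ∑-allSubsets-suc (λ X → χ (X ≟ˢ (c ∷ S))) ⟩
  (∑[ X ← allSubsets n ] χ ((inside ∷ X) ≟ˢ (c ∷ S))) + (∑[ X ← allSubsets n ] χ ((outside ∷ X) ≟ˢ (c ∷ S)))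
    ≡⟨ cong₂ _+_ (count inside) (count outside) ⟩
  χ (inside Bool.≟ c) + χ (outside Bool.≟ c)
    ≡⟨ one-of c ⟩
  1 ∎
  where
  open ≡-Reasoning
  count : ∀ b → ∑[ X ← allSubsets n ] χ ((b ∷ X) ≟ˢ (c ∷ S)) ≡ χ (b Bool.≟ c)
  count b = begin
    ∑[ X ← allSubsets n ] χ ((b ∷ X) ≟ˢ (c ∷ S))     ≡⟨ ∑-cong (allSubsets n) (λ X → χ-∷-≟ b c X S) ⟩
    ∑[ X ← allSubsets n ] χ (b Bool.≟ c) * χ (X ≟ˢ S) ≡⟨ ∑-distribˡ-* (allSubsets n) (χ (b Bool.≟ c)) (λ X → χ (X ≟ˢ S)) ⟩
    χ (b Bool.≟ c) * (∑[ X ← allSubsets n ] χ (X ≟ˢ S)) ≡⟨ cong (χ (b Bool.≟ c) *_) (allSubsets-once n S) ⟩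
    χ (b Bool.≟ c) * 1                               ≡⟨ *-identityʳ _ ⟩
    χ (b Bool.≟ c)                                   ∎
  one-of : ∀ c → χ (inside Bool.≟ c) + χ (outside Bool.≟ c) ≡ 1
  one-of true  = refl
  one-of false = refl

allSubsets-enumerates : ∀ n → Enumerates _≟ˢ_ (allSubsets n)
allSubsets-enumerates n = occurs-once (allSubsets-once n)

subset : ∀ {n} {P : Fin n → Set} → (∀ x → Dec (P x)) → Subset n
subset P? = tabulate (λ x → ⌊ P? x ⌋)

∈-subset⁺ : ∀ {n} {P : Fin n → Set} (P? : ∀ x → Dec (P x)) {x} → P x → x ∈ subset P?
∈-subset⁺ P? {zero} p with P? zero
... | yes _ = here
... | no ¬p = ⊥-elim (¬p p)
∈-subset⁺ P? {suc x} p = there (∈-subset⁺ (P? ∘ suc) p)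

∈-subset⁻ : ∀ {n} {P : Fin n → Set} (P? : ∀ x → Dec (P x)) {x} → x ∈ subset P? → P x
∈-subset⁻ P? {zero} x∈ with P? zero | x∈
... | yes p | _ = p
∈-subset⁻ P? {suc x} (there x∈) = ∈-subset⁻ (P? ∘ suc) x∈

∣p∣≡∑χ : ∀ {n} (p : Subset n) → ∣ p ∣ ≡ ∑[ x ← allFin n ] χ (x ∈? p)
∣p∣≡∑χ []      = refl
∣p∣≡∑χ (b ∷ p) = begin
  ∣ b ∷ p ∣                                            ≡⟨ head b ⟩
  χ (zero ∈? (b ∷ p)) + ∣ p ∣                          ≡⟨ cong (χ (zero ∈? (b ∷ p)) +_) (∣p∣≡∑χ p) ⟩
  χ (zero ∈? (b ∷ p)) + (∑[ x ← allFin _ ] χ (x ∈? p)) ≡⟨ cong (χ (zero ∈? (b ∷ p)) +_) (∑-cong (allFin _) tail) ⟩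
  χ (zero ∈? (b ∷ p)) + (∑[ x ← allFin _ ] χ (suc x ∈? (b ∷ p))) ≡⟨ ∑-allFin-suc (λ x → χ (x ∈? (b ∷ p))) ⟨
  ∑[ x ← allFin _ ] χ (x ∈? (b ∷ p))                  ∎
  where
  open ≡-Reasoning
  head : ∀ b → ∣ b ∷ p ∣ ≡ χ (zero ∈? (b ∷ p)) + ∣ p ∣
  head true  = refl
  head false = refl
  tail : ∀ x → χ (x ∈? p) ≡ χ (suc x ∈? (b ∷ p))
  tail x = χ-cong (x ∈? p) (suc x ∈? (b ∷ p)) there drop-there

∣subset∣≡∑χ : ∀ {n} {P : Fin n → Set} (P? : ∀ x → Dec (P x)) → ∣ subset P? ∣ ≡ ∑[ x ← allFin n ] χ (P? x)
∣subset∣≡∑χ P? = trans (∣p∣≡∑χ (subset P?))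
  (∑-cong (allFin _) (λ x → χ-cong (x ∈? subset P?) (P? x) (∈-subset⁻ P?) (∈-subset⁺ P?)))

∣p∪q∣≡∣p∣+∣q∣ : ∀ {n} {p q : Subset n} → (∀ {x} → x ∈ p → x ∉ q) → ∣ p ∪ q ∣ ≡ ∣ p ∣ + ∣ q ∣
∣p∪q∣≡∣p∣+∣q∣ {n} {p} {q} disjoint = begin
  ∣ p ∪ q ∣                                                 ≡⟨ ∣p∣≡∑χ (p ∪ q) ⟩
  ∑[ x ← allFin n ] χ (x ∈? p ∪ q)                          ≡⟨ ∑-cong (allFin n) split ⟩
  ∑[ x ← allFin n ] (χ (x ∈? p) + χ (x ∈? q))               ≡⟨ ∑-distrib-+ (allFin n) _ _ ⟩
  (∑[ x ← allFin n ] χ (x ∈? p)) + (∑[ x ← allFin n ] χ (x ∈? q)) ≡⟨ cong₂ _+_ (∣p∣≡∑χ p) (∣p∣≡∑χ q) ⟨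
  ∣ p ∣ + ∣ q ∣                                             ∎
  where
  open ≡-Reasoning
  split : ∀ x → χ (x ∈? p ∪ q) ≡ χ (x ∈? p) + χ (x ∈? q)
  split x with x ∈? p | x ∈? q
  ... | yes x∈p | yes x∈q = ⊥-elim (disjoint x∈p x∈q)
  ... | yes x∈p | no _    = χ-yes (x ∈? p ∪ q) (x∈p∪q⁺ (inj₁ x∈p))
  ... | no _    | yes x∈q = χ-yes (x ∈? p ∪ q) (x∈p∪q⁺ (inj₂ x∈q))
  ... | no x∉p  | no x∉q  = χ-no (x ∈? p ∪ q) ([ x∉p , x∉q ]′ ∘ x∈p∪q⁻ p q)

∣p∪⁅x⁆∣≡1+∣p∣ : ∀ {n} {p : Subset n} {x} → x ∉ p → ∣ p ∪ ⁅ x ⁆ ∣ ≡ suc ∣ p ∣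
∣p∪⁅x⁆∣≡1+∣p∣ {p = p} {x} x∉p =
  trans (∣p∪q∣≡∣p∣+∣q∣ (λ y∈p y∈⁅x⁆ → x∉p (subst (_∈ p) (x∈⁅y⁆⇒x≡y x y∈⁅x⁆) y∈p)))
        (trans (cong (∣ p ∣ +_) (∣⁅x⁆∣≡1 x)) (+-comm ∣ p ∣ 1))

-- (a , a′) ≋ (b , b′) states a − a′ = b − b′ without truncated subtraction.
infix 4 _≋_
record _≋_ (p q : ℕ × ℕ) : Set where
  constructor cross
  field uncross : proj₁ p + proj₂ q ≡ proj₁ q + proj₂ p
open _≋_ public

≋-refl : ∀ {p} → p ≋ p
≋-refl = cross refl

≋-sym : ∀ {p q} → p ≋ q → q ≋ p
≋-sym (cross eq) = cross (sym eq)

≋-trans : ∀ {p q s} → p ≋ q → q ≋ s → p ≋ s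
≋-trans {a , a′} {b , b′} {c , c′} (cross p≋q) (cross q≋s) = cross (+-cancelʳ-≡ (b + b′) _ _ (begin
  a + c′ + (b + b′)     ≡⟨ solve 4 (λ a b′ b c′ → a :+ c′ :+ (b :+ b′) := a :+ b′ :+ (b :+ c′)) refl a b′ b c′ ⟩
  a + b′ + (b + c′)     ≡⟨ cong₂ _+_ p≋q q≋s ⟩
  b + a′ + (c + b′)     ≡⟨ solve 4 (λ b a′ c b′ → b :+ a′ :+ (c :+ b′) := c :+ a′ :+ (b :+ b′)) refl b a′ c b′ ⟩
  c + a′ + (b + b′)     ∎))
  where open ≡-Reasoning

≋-cancel : ∀ {a a′ b b′} → (a , a′) ≋ (b , b′) → a ≡ a′ → b ≡ b′
≋-cancel {a} {a′} {b} {b′} (cross a+b′≡b+a′) refl = sym (+-cancelʳ-≡ a b′ b (trans (+-comm b′ a) a+b′≡b+a′))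

≋-rebase : ∀ {a a′ b b′ c c′} → (a , a′) ≋ (b , b′) → (c , a′) ≋ (c′ , b′) → (a , c) ≋ (b , c′)
≋-rebase {a} {a′} {b} {b′} {c} {c′} (cross p≋q) (cross p′≋q′) = cross (+-cancelʳ-≡ (a′ + b′) _ _ (begin
  a + c′ + (a′ + b′)    ≡⟨ solve 4 (λ a c′ a′ b′ → a :+ c′ :+ (a′ :+ b′) := a :+ b′ :+ (c′ :+ a′)) refl a c′ a′ b′ ⟩
  a + b′ + (c′ + a′)    ≡⟨ cong₂ _+_ p≋q (sym p′≋q′) ⟩
  b + a′ + (c + b′)     ≡⟨ solve 4 (λ b a′ c b′ → b :+ a′ :+ (c :+ b′) := b :+ c :+ (a′ :+ b′)) refl b a′ c b′ ⟩
  b + c + (a′ + b′)     ∎))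
  where open ≡-Reasoning

module Subtransversals {n m : ℕ} (σ : Fin n → Fin m) where

  Avoids : Subset n → Fin n → Set
  Avoids S z = ∀ y → y ∈ S → σ y ≢ σ z

  ST : Subset n → Set
  ST = IsSubtransversal σ

  ST-⊆ : ∀ {X Y} → X ⊆ Y → ST Y → ST X
  ST-⊆ X⊆Y stY x y x∈X y∈X = stY x y (X⊆Y x∈X) (X⊆Y y∈X)

  ST-∅ : ST ∅
  ST-∅ x _ x∈∅ = ⊥-elim (∉⊥ x∈∅)

  ST-⁅⁆ : ∀ z → ST ⁅ z ⁆
  ST-⁅⁆ z x y x∈ y∈ _ = trans (x∈⁅y⁆⇒x≡y z x∈) (sym (x∈⁅y⁆⇒x≡y z y∈))

  ST-∪ : ∀ {X Y} → ST X → ST Y → (∀ x y → x ∈ X → y ∈ Y → σ x ≢ σ y) → ST (X ∪ Y)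
  ST-∪ {X} {Y} stX stY apart x y x∈ y∈ σx≡σy with x∈p∪q⁻ X Y x∈ | x∈p∪q⁻ X Y y∈
  ... | inj₁ x∈X | inj₁ y∈X = stX x y x∈X y∈X σx≡σy
  ... | inj₁ x∈X | inj₂ y∈Y = ⊥-elim (apart x y x∈X y∈Y σx≡σy)
  ... | inj₂ x∈Y | inj₁ y∈X = ⊥-elim (apart y x y∈X x∈Y (sym σx≡σy))
  ... | inj₂ x∈Y | inj₂ y∈Y = stY x y x∈Y y∈Y σx≡σy

  ST-add : ∀ {S z} → ST S → Avoids S z → ST (S ∪ ⁅ z ⁆)
  ST-add {S} {z} stS avoids = ST-∪ stS (ST-⁅⁆ z)
    (λ x y x∈S y∈z σx≡σy → avoids x x∈S (trans σx≡σy (cong σ (x∈⁅y⁆⇒x≡y z y∈z))))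

  Avoids-∪ : ∀ {X Y z} → Avoids X z → Avoids Y z → Avoids (X ∪ Y) z
  Avoids-∪ {X} {Y} avX avY y y∈ = [ avX y , avY y ]′ (x∈p∪q⁻ X Y y∈)

  Avoids-skew : ∀ {S x y} → σ x ≡ σ y → Avoids S y → Avoids S x
  Avoids-skew σx≡σy avoids z z∈S σz≡σx = avoids z z∈S (trans σz≡σx σx≡σy)

  Avoids⇒∉ : ∀ {S z} → Avoids S z → z ∉ S
  Avoids⇒∉ avoids z∈S = avoids _ z∈S refl

  -- (R1) only constrains the rank on transversals, so a subtransversal S is completed to one by
  -- adding a chosen element of every class that S misses.
  module Completion (section : Fin m → Fin n) (section-σ : ∀ ω → σ (section ω) ≡ ω) (S : Subset n) where

    Meets : Fin m → Set
    Meets ω = ∃ λ y → y ∈ S × σ y ≡ ω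

    meets? : ∀ ω → Dec (Meets ω)
    meets? ω = any? (λ y → (y ∈? S) ×-dec (σ y Fin.≟ ω))

    Filler : Fin n → Set
    Filler x = x ≡ section (σ x) × ¬ Meets (σ x)

    filler? : ∀ x → Dec (Filler x)
    filler? x = (x Fin.≟ section (σ x)) ×-dec ¬? (meets? (σ x))

    complete : Subset n
    complete = S ∪ subset filler?

    complete-transversal : ST S → IsTransversal σ complete
    complete-transversal stS = ST-∪ stS fillers-ST apart , covers
      where
      fillers-ST : ST (subset filler?)
      fillers-ST x y x∈ y∈ σx≡σy =
        trans (proj₁ (∈-subset⁻ filler? x∈)) (trans (cong section σx≡σy) (sym (proj₁ (∈-subset⁻ filler? y∈))))
      apart : ∀ x y → x ∈ S → y ∈ subset filler? → σ x ≢ σ y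
      apart x y x∈S y∈ σx≡σy = proj₂ (∈-subset⁻ filler? y∈) (x , x∈S , σx≡σy)
      covers : ∀ ω → ∃ λ x → x ∈ complete × σ x ≡ ω
      covers ω with meets? ω
      ... | yes (y , y∈S , σy≡ω) = y , p⊆p∪q _ y∈S , σy≡ω
      ... | no ¬meets = section ω , q⊆p∪q S _ (∈-subset⁺ filler? (filler ω ¬meets)) , section-σ ω
        where
        filler : ∀ ω → ¬ Meets ω → Filler (section ω)
        filler ω ¬meets rewrite section-σ ω = refl , ¬meets

module Rank {n m : ℕ} (Z : Multimatroid n m) where

  open Subtransversals (σ Z) public

  private
    ρ : Subset n → ℕ
    ρ = r Z

  module _ {S : Subset n} (stS : ST S) where
    open Completion (proj₁ ∘ σ-surj Z) (proj₂ ∘ σ-surj Z) S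

    rank-on-completion : IsMatroidRankOn ρ complete
    rank-on-completion = R1 Z complete (complete-transversal stS)

    S⊆complete : S ⊆ complete
    S⊆complete = p⊆p∪q _

  r≤∣∣ : ∀ {X} → ST X → ρ X ≤ ∣ X ∣
  r≤∣∣ stX = proj₁ (rank-on-completion stX) _ (S⊆complete stX)

  r-mono : ∀ {X Y} → X ⊆ Y → ST Y → ρ X ≤ ρ Y
  r-mono X⊆Y stY = proj₁ (proj₂ (rank-on-completion stY)) _ _ X⊆Y (S⊆complete stY)

  r-submodular : ∀ {X Y} → ST (X ∪ Y) → ρ (X ∪ Y) + ρ (X ∩ Y) ≤ ρ X + ρ Y
  r-submodular {X} {Y} st = proj₂ (proj₂ (rank-on-completion st)) X Y
    (S⊆complete st ∘ p⊆p∪q Y) (S⊆complete st ∘ q⊆p∪q X Y)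

  r-subadditive : ∀ {X Y} → ST (X ∪ Y) → ρ (X ∪ Y) ≤ ρ X + ρ Y
  r-subadditive {X} {Y} st = ≤-trans (m≤m+n _ _) (r-submodular {X} {Y} st)

  r-add≤ : ∀ {S z} → ST (S ∪ ⁅ z ⁆) → ρ (S ∪ ⁅ z ⁆) ≤ suc (ρ S)
  r-add≤ {S} {z} st = begin
    ρ (S ∪ ⁅ z ⁆) ≤⟨ r-subadditive {S} st ⟩
    ρ S + ρ ⁅ z ⁆ ≤⟨ +-monoʳ-≤ (ρ S) (≤-trans (r≤∣∣ (ST-⁅⁆ z)) (≤-reflexive (∣⁅x⁆∣≡1 z))) ⟩
    ρ S + 1       ≡⟨ +-comm (ρ S) 1 ⟩
    suc (ρ S)     ∎
    where open ≤-Reasoning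

  Independent : Subset n → Set
  Independent X = ρ X ≡ ∣ X ∣

  independent-⊆ : ∀ {X Y} → X ⊆ Y → ST Y → Independent Y → Independent X
  independent-⊆ {X} {Y} X⊆Y stY indY = ≤-antisym (r≤∣∣ (ST-⊆ X⊆Y stY)) (+-cancelʳ-≤ ∣ W ∣ ∣ X ∣ (ρ X) chain)
    where
    only-in-Y? : ∀ x → Dec (x ∈ Y × x ∉ X)
    only-in-Y? x = (x ∈? Y) ×-dec ¬? (x ∈? X)
    W : Subset n
    W = subset only-in-Y?
    X∪W⊆Y : X ∪ W ⊆ Y
    X∪W⊆Y x∈ = [ X⊆Y , proj₁ ∘ ∈-subset⁻ only-in-Y? ]′ (x∈p∪q⁻ X W x∈)
    Y⊆X∪W : Y ⊆ X ∪ W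
    Y⊆X∪W {x} x∈Y with x ∈? X
    ... | yes x∈X = p⊆p∪q W x∈X
    ... | no x∉X  = q⊆p∪q X W (∈-subset⁺ only-in-Y? (x∈Y , x∉X))
    stX∪W = ST-⊆ X∪W⊆Y stY
    chain : ∣ X ∣ + ∣ W ∣ ≤ ρ X + ∣ W ∣
    chain = begin
      ∣ X ∣ + ∣ W ∣ ≡⟨ ∣p∪q∣≡∣p∣+∣q∣ {p = X} {q = W} (λ x∈X x∈W → proj₂ (∈-subset⁻ only-in-Y? x∈W) x∈X) ⟨
      ∣ X ∪ W ∣     ≤⟨ p⊆q⇒∣p∣≤∣q∣ X∪W⊆Y ⟩
      ∣ Y ∣         ≡⟨ indY ⟨
      ρ Y           ≤⟨ r-mono Y⊆X∪W stX∪W ⟩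
      ρ (X ∪ W)     ≤⟨ r-subadditive {X} stX∪W ⟩
      ρ X + ρ W     ≤⟨ +-monoʳ-≤ (ρ X) (r≤∣∣ (ST-⊆ (proj₁ ∘ ∈-subset⁻ only-in-Y?) stY)) ⟩
      ρ X + ∣ W ∣   ∎
      where open ≤-Reasoning

  Spans : Subset n → Fin n → Set
  Spans S y = ρ (S ∪ ⁅ y ⁆) ≡ ρ S

  spans? : ∀ S y → Dec (Spans S y)
  spans? S y = ρ (S ∪ ⁅ y ⁆) ℕ.≟ ρ S

  ¬spans⇒r-suc : ∀ {S z} → ST (S ∪ ⁅ z ⁆) → ¬ Spans S z → ρ (S ∪ ⁅ z ⁆) ≡ suc (ρ S)
  ¬spans⇒r-suc {S} st ¬spans = ≤-antisym (r-add≤ {S} st) (≤∧≢⇒< (r-mono (p⊆p∪q _) st) (¬spans ∘ sym))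

  independent-add : ∀ {S z} → ST S → Avoids S z → Independent S → ¬ Spans S z → Independent (S ∪ ⁅ z ⁆)
  independent-add {S} {z} stS avoids indS ¬spans = begin
    ρ (S ∪ ⁅ z ⁆) ≡⟨ ¬spans⇒r-suc (ST-add stS avoids) ¬spans ⟩
    suc (ρ S)     ≡⟨ cong suc indS ⟩
    suc ∣ S ∣     ≡⟨ ∣p∪⁅x⁆∣≡1+∣p∣ (Avoids⇒∉ avoids) ⟨
    ∣ S ∪ ⁅ z ⁆ ∣ ∎
    where open ≡-Reasoning

  nullity-add : ∀ {S z} → ST S → Avoids S z → nullity Z (S ∪ ⁅ z ⁆) ≡ χ (spans? S z) + nullity Z S
  nullity-add {S} {z} stS avoids with spans? S z
  ... | yes spans = begin
    ∣ S ∪ ⁅ z ⁆ ∣ ∸ ρ (S ∪ ⁅ z ⁆) ≡⟨ cong₂ _∸_ (∣p∪⁅x⁆∣≡1+∣p∣ (Avoids⇒∉ avoids)) spans ⟩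
    suc ∣ S ∣ ∸ ρ S               ≡⟨ +-∸-assoc 1 (r≤∣∣ stS) ⟩
    suc (∣ S ∣ ∸ ρ S)             ∎
    where open ≡-Reasoning
  ... | no ¬spans = cong₂ _∸_ (∣p∪⁅x⁆∣≡1+∣p∣ (Avoids⇒∉ avoids)) (¬spans⇒r-suc (ST-add stS avoids) ¬spans)

  spans-unique : ∀ {S x y} → ST S → x ≢ y → σ Z x ≡ σ Z y → Avoids S x → Spans S x → Spans S y → ⊥
  spans-unique {S} {x} {y} stS x≢y σx≡σy avoids spans-x spans-y = <-irrefl refl (begin-strict
    2 * ρ S                           <⟨ n<1+n _ ⟩
    1 + 2 * ρ S                       ≤⟨ R2 Z S x y stS x≢y σx≡σy avoids ⟩
    ρ (S ∪ ⁅ x ⁆) + ρ (S ∪ ⁅ y ⁆)     ≡⟨ cong₂ _+_ spans-x spans-y ⟩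
    ρ S + ρ S                         ≡⟨ cong (ρ S +_) (+-identityʳ (ρ S)) ⟨
    2 * ρ S                           ∎)
    where open ≤-Reasoning

  spans-mono : ∀ {S R y} → ST R → S ⊆ R → Avoids R y → Spans S y → Spans R y
  spans-mono {S} {R} {y} stR S⊆R avoids spans =
    ≤-antisym (+-cancelʳ-≤ (ρ S) _ _ chain) (r-mono (p⊆p∪q _) stR∪y)
    where
    stR∪y = ST-add stR avoids
    R∪S∪y⊆R∪y : R ∪ (S ∪ ⁅ y ⁆) ⊆ R ∪ ⁅ y ⁆
    R∪S∪y⊆R∪y x∈ = [ p⊆p∪q _ , [ p⊆p∪q _ ∘ S⊆R , q⊆p∪q R _ ]′ ∘ x∈p∪q⁻ S _ ]′ (x∈p∪q⁻ R _ x∈)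
    R∪y⊆R∪S∪y : R ∪ ⁅ y ⁆ ⊆ R ∪ (S ∪ ⁅ y ⁆)
    R∪y⊆R∪S∪y x∈ = [ p⊆p∪q _ , q⊆p∪q R _ ∘ q⊆p∪q S _ ]′ (x∈p∪q⁻ R _ x∈)
    stR∪S∪y = ST-⊆ R∪S∪y⊆R∪y stR∪y
    chain : ρ (R ∪ ⁅ y ⁆) + ρ S ≤ ρ R + ρ S
    chain = begin
      ρ (R ∪ ⁅ y ⁆) + ρ S
        ≤⟨ +-mono-≤ (r-mono R∪y⊆R∪S∪y stR∪S∪y)
                    (r-mono (λ x∈S → x∈p∩q⁺ (S⊆R x∈S , p⊆p∪q _ x∈S)) (ST-⊆ (proj₁ ∘ x∈p∩q⁻ R _) stR)) ⟩
      ρ (R ∪ (S ∪ ⁅ y ⁆)) + ρ (R ∩ (S ∪ ⁅ y ⁆)) ≤⟨ r-submodular {R} stR∪S∪y ⟩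
      ρ R + ρ (S ∪ ⁅ y ⁆)                       ≡⟨ cong (ρ R +_) spans ⟩
      ρ R + ρ S                                 ∎
      where open ≤-Reasoning

  spans⇒skew-r-suc : ∀ {S x y} → ST S → Avoids S y → Spans S y → x ≢ y → σ Z x ≡ σ Z y →
                     ρ (S ∪ ⁅ x ⁆) ≡ suc (ρ S)
  spans⇒skew-r-suc stS avoids spans-y x≢y σx≡σy =
    ¬spans⇒r-suc (ST-add stS avoids′) (λ spans-x → spans-unique stS x≢y σx≡σy avoids′ spans-x spans-y)
    where avoids′ = Avoids-skew σx≡σy avoids

  r-increment-extend : ∀ {S X x y} → ST (S ∪ X) → Avoids S y → Avoids X y → Spans S y → σ Z x ≡ σ Z y →
                       (ρ ((S ∪ ⁅ x ⁆) ∪ X) , ρ (S ∪ ⁅ x ⁆)) ≋ (ρ (S ∪ X) , ρ S)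
  r-increment-extend {S} {X} {x} {y} stS∪X avS avX spans σx≡σy
    rewrite ∪-assoc S ⁅ x ⁆ X | ∪-comm ⁅ x ⁆ X | sym (∪-assoc S X ⁅ x ⁆) = cross (increment (x Fin.≟ y))
    where
    avS∪X = Avoids-∪ {S} avS avX
    spans∪X = spans-mono stS∪X (p⊆p∪q _) avS∪X spans
    stS = ST-⊆ (p⊆p∪q _) stS∪X
    increment : Dec (x ≡ y) → ρ ((S ∪ X) ∪ ⁅ x ⁆) + ρ S ≡ ρ (S ∪ X) + ρ (S ∪ ⁅ x ⁆)
    increment (yes refl) = cong₂ _+_ spans∪X (sym spans)
    increment (no x≢y) = begin
      ρ ((S ∪ X) ∪ ⁅ x ⁆) + ρ S     ≡⟨ cong (_+ ρ S) (spans⇒skew-r-suc stS∪X avS∪X spans∪X x≢y σx≡σy) ⟩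
      suc (ρ (S ∪ X)) + ρ S         ≡⟨ +-suc (ρ (S ∪ X)) (ρ S) ⟨
      ρ (S ∪ X) + suc (ρ S)         ≡⟨ cong (ρ (S ∪ X) +_) (spans⇒skew-r-suc stS avS spans x≢y σx≡σy) ⟨
      ρ (S ∪ X) + ρ (S ∪ ⁅ x ⁆)     ∎
      where open ≡-Reasoning

module UpSets {m : ℕ} {_≺_ : Rel (Fin m) 0ℓ} (sto : IsStrictTotalOrder _≡_ _≺_) where

  open IsStrictTotalOrder sto using (compare; _<?_) renaming (trans to ≺-trans; irrefl to ≺-irrefl)

  above : Fin m → Subset m
  above ω = subset (ω <?_)

  atLeast : Fin m → Subset m
  atLeast ω = subset (λ ω′ → (ω Fin.≟ ω′) ⊎-dec (ω <? ω′))

  ω∈atLeast : ∀ ω → ω ∈ atLeast ω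
  ω∈atLeast ω = ∈-subset⁺ _ (inj₁ refl)

  ω∉above : ∀ ω → ω ∉ above ω
  ω∉above ω ω∈ = ≺-irrefl refl (∈-subset⁻ _ ω∈)

  above⊆atLeast : ∀ {ω} → above ω ⊆ atLeast ω
  above⊆atLeast ω′∈ = ∈-subset⁺ _ (inj₂ (∈-subset⁻ _ ω′∈))

  atLeast-split : ∀ {ω ω′} → ω′ ∈ atLeast ω → ω ≡ ω′ ⊎ ω′ ∈ above ω
  atLeast-split ω′∈ = [ inj₁ , inj₂ ∘ ∈-subset⁺ _ ]′ (∈-subset⁻ _ ω′∈)

  UpClosed : Subset m → Set
  UpClosed K = ∀ {a b} → a ∈ K → a ≺ b → b ∈ K

  above-upClosed : ∀ ω → UpClosed (above ω)
  above-upClosed ω a∈ a≺b = ∈-subset⁺ _ (≺-trans (∈-subset⁻ _ a∈) a≺b)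

  ⊤-upClosed : UpClosed ⊤
  ⊤-upClosed _ _ = ∈⊤

  IsMinimum : Subset m → Fin m → Set
  IsMinimum K μ = μ ∈ K × (∀ {ω} → ω ∈ K → ω ≢ μ → μ ≺ ω)

  minimum : ∀ K {ω} → ω ∈ K → ∃ (IsMinimum K)
  minimum K {ω} ω∈K = let μ , μ∈K , least = go (allFin m) in μ , μ∈K , λ ω′∈ → least (∈-allFin _) ω′∈
    where
    go : ∀ ωs → ∃ λ μ → μ ∈ K × (∀ {ω′} → ω′ ∈ₗ ωs → ω′ ∈ K → ω′ ≢ μ → μ ≺ ω′)
    go [] = ω , ω∈K , λ ()
    go (α ∷ ωs) with go ωs | α ∈? K
    ... | μ , μ∈K , least | no α∉K = μ , μ∈K , λ { (here refl) α∈K _ → ⊥-elim (α∉K α∈K) ; (there p) → least p }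
    ... | μ , μ∈K , least | yes α∈K with compare α μ
    ...   | tri≈ _ refl _ = μ , μ∈K , λ { (here refl) _ α≢μ → ⊥-elim (α≢μ refl) ; (there p) → least p }
    ...   | tri> _ _ μ≺α  = μ , μ∈K , λ { (here refl) _ _ → μ≺α ; (there p) → least p }
    ...   | tri< α≺μ _ _  = α , α∈K , λ { (here refl) _ α≢α → ⊥-elim (α≢α refl) ; (there p) → below p }
      where
      below : ∀ {ω′} → ω′ ∈ₗ ωs → ω′ ∈ K → ω′ ≢ α → α ≺ ω′
      below {ω′} p ω′∈K _ with ω′ Fin.≟ μ
      ... | yes refl = α≺μ
      ... | no ω′≢μ  = ≺-trans α≺μ (least p ω′∈K ω′≢μ)

  module _ (P : Subset m → Set) (P-∅ : P ∅) (P-step : ∀ ω → P (above ω) → P (atLeast ω)) where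

    upClosed-induction : ∀ K → UpClosed K → P K
    upClosed-induction K = go K (<-wellFounded _)
      where
      go : ∀ K → Acc _<_ ∣ K ∣ → UpClosed K → P K
      go K (acc smaller) up with nonempty? K
      ... | no empty = subst P (sym (Empty-unique empty)) P-∅
      ... | yes (_ , ω∈K) with minimum K ω∈K
      ...   | μ , μ∈K , least = subst P (sym K≡atLeast-μ) (P-step μ P-above)
        where
        above⊆K : above μ ⊆ K
        above⊆K ω∈ = up μ∈K (∈-subset⁻ _ ω∈)
        K≡atLeast-μ : K ≡ atLeast μ
        K≡atLeast-μ = ⊆-antisym from-K to-K
          where
          from-K : K ⊆ atLeast μ
          from-K {ω} ω∈K with ω Fin.≟ μ
          ... | yes refl = ω∈atLeast μ
          ... | no ω≢μ   = ∈-subset⁺ _ (inj₂ (least ω∈K ω≢μ))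
          to-K : atLeast μ ⊆ K
          to-K ω∈ = [ (λ { refl → μ∈K }) , above⊆K ]′ (atLeast-split ω∈)
        P-above : P (above μ)
        P-above = go (above μ) (smaller (p⊂q⇒∣p∣<∣q∣ (above⊆K , μ , μ∈K , ω∉above μ))) (above-upClosed μ)

module Restriction {n m : ℕ} (σ : Fin n → Fin m) {_≺_ : Rel (Fin m) 0ℓ} (sto : IsStrictTotalOrder _≡_ _≺_) where

  open Subtransversals σ
  open UpSets sto

  infixl 7 _↾_
  _↾_ : Subset n → Subset m → Subset n
  T ↾ K = subset (λ x → (x ∈? T) ×-dec (σ x ∈? K))

  ↾⁺ : ∀ {T K x} → x ∈ T → σ x ∈ K → x ∈ T ↾ K
  ↾⁺ x∈T σx∈K = ∈-subset⁺ _ (x∈T , σx∈K)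

  ↾⁻ : ∀ {T K x} → x ∈ T ↾ K → x ∈ T × σ x ∈ K
  ↾⁻ = ∈-subset⁻ _

  ↾-⊆ : ∀ {T K} → T ↾ K ⊆ T
  ↾-⊆ = proj₁ ∘ ↾⁻

  ↾-↾ : ∀ {T K K′} → K′ ⊆ K → T ↾ K ↾ K′ ≡ T ↾ K′
  ↾-↾ K′⊆K = ⊆-antisym (λ x∈ → ↾⁺ (↾-⊆ (↾-⊆ x∈)) (proj₂ (↾⁻ x∈)))
                       (λ x∈ → let x∈T , σx∈K′ = ↾⁻ x∈ in ↾⁺ (↾⁺ x∈T (K′⊆K σx∈K′)) σx∈K′)

  avoids-above : ∀ {S z ω} → (∀ x → x ∈ S → σ x ∈ above ω) → σ z ≡ ω → Avoids S z
  avoids-above {ω = ω} confined σz≡ω y y∈S σy≡σz = ω∉above ω (subst (_∈ above ω) (trans σy≡σz σz≡ω) (confined y y∈S))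

  ↾above-avoids : ∀ {T z ω} → σ z ≡ ω → Avoids (T ↾ above ω) z
  ↾above-avoids = avoids-above (λ _ → proj₂ ∘ ↾⁻)

  TransversalOn : Subset m → Subset n → Set
  TransversalOn K T = ST T × (∀ x → x ∈ T → σ x ∈ K) × (∀ ω → ω ∈ K → ∃ λ x → x ∈ T × σ x ≡ ω)

  transversalOn? : ∀ K T → Dec (TransversalOn K T)
  transversalOn? K T = subtransversal? σ T
    ×-dec (all? λ x → (x ∈? T) →-dec (σ x ∈? K))
    ×-dec (all? λ ω → (ω ∈? K) →-dec any? (λ x → (x ∈? T) ×-dec (σ x Fin.≟ ω)))

  transversal⇒transversalOn-⊤ : ∀ {T} → IsTransversal σ T → TransversalOn ⊤ T
  transversal⇒transversalOn-⊤ (stT , covers) = stT , (λ _ _ → ∈⊤) , (λ ω _ → covers ω)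

  transversalOn-⊤⇒transversal : ∀ {T} → TransversalOn ⊤ T → IsTransversal σ T
  transversalOn-⊤⇒transversal (stT , _ , covers) = stT , λ ω → covers ω ∈⊤

  transversalOn-∅⇒≡∅ : ∀ {T} → TransversalOn ∅ T → T ≡ ∅
  transversalOn-∅⇒≡∅ (_ , confined , _) = ⊆-antisym (λ x∈T → ⊥-elim (∉⊥ (confined _ x∈T))) (⊥-elim ∘ ∉⊥)

  ∅-transversalOn-∅ : TransversalOn ∅ ∅
  ∅-transversalOn-∅ = ST-∅ , (λ _ x∈∅ → ⊥-elim (∉⊥ x∈∅)) , (λ _ ω∈∅ → ⊥-elim (∉⊥ ω∈∅))

  transversalOn-↾ : ∀ {K K′ T} → TransversalOn K T → K′ ⊆ K → TransversalOn K′ (T ↾ K′)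
  transversalOn-↾ (stT , _ , covers) K′⊆K =
    ST-⊆ ↾-⊆ stT , (λ _ → proj₂ ∘ ↾⁻) ,
    λ ω ω∈K′ → let x , x∈T , σx≡ω = covers ω (K′⊆K ω∈K′) in x , ↾⁺ x∈T (subst (_∈ _) (sym σx≡ω) ω∈K′) , σx≡ω

  ↾-idem : ∀ {K T} → TransversalOn K T → T ↾ K ≡ T
  ↾-idem (_ , confined , _) = ⊆-antisym ↾-⊆ (λ x∈T → ↾⁺ x∈T (confined _ x∈T))

  transversalOn-split : ∀ {ω T} → TransversalOn (atLeast ω) T →
                        ∃ λ z → z ∈ T × σ z ≡ ω × T ≡ T ↾ above ω ∪ ⁅ z ⁆
  transversalOn-split {ω} {T} (stT , confined , covers) with covers ω (ω∈atLeast ω)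
  ... | z , z∈T , σz≡ω = z , z∈T , σz≡ω , ⊆-antisym into from
    where
    into : T ⊆ T ↾ above ω ∪ ⁅ z ⁆
    into {x} x∈T with atLeast-split (confined x x∈T)
    ... | inj₁ ω≡σx = q⊆p∪q _ _ (subst (_∈ ⁅ z ⁆) (sym (stT x z x∈T z∈T (trans (sym ω≡σx) (sym σz≡ω)))) (x∈⁅x⁆ z))
    ... | inj₂ σx∈  = p⊆p∪q _ (↾⁺ x∈T σx∈)
    from : T ↾ above ω ∪ ⁅ z ⁆ ⊆ T
    from x∈ = [ ↾-⊆ , (λ x∈z → subst (_∈ T) (sym (x∈⁅y⁆⇒x≡y z x∈z)) z∈T) ]′ (x∈p∪q⁻ _ _ x∈)

  transversalOn-join : ∀ {ω S z} → TransversalOn (above ω) S → σ z ≡ ω → TransversalOn (atLeast ω) (S ∪ ⁅ z ⁆)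
  transversalOn-join {ω} {S} {z} (stS , confined , covers) σz≡ω =
    ST-add stS (avoids-above confined σz≡ω) , confined′ , covers′
    where
    confined′ : ∀ x → x ∈ S ∪ ⁅ z ⁆ → σ x ∈ atLeast ω
    confined′ x x∈ = [ above⊆atLeast ∘ confined x
                     , (λ x∈z → subst (_∈ atLeast ω) (sym (trans (cong σ (x∈⁅y⁆⇒x≡y z x∈z)) σz≡ω)) (ω∈atLeast ω)) ]′
                     (x∈p∪q⁻ S _ x∈)
    covers′ : ∀ ω′ → ω′ ∈ atLeast ω → ∃ λ x → x ∈ S ∪ ⁅ z ⁆ × σ x ≡ ω′
    covers′ ω′ ω′∈ with atLeast-split ω′∈
    ... | inj₁ refl = z , q⊆p∪q S _ (x∈⁅x⁆ z) , σz≡ω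
    ... | inj₂ ω′∈above = let x , x∈S , σx≡ω′ = covers ω′ ω′∈above in x , p⊆p∪q _ x∈S , σx≡ω′

  Decomposes : Fin m → Subset n → Fin n → Set
  Decomposes ω S′ z = TransversalOn (above ω) S′ × σ z ≡ ω

  decomposes? : ∀ ω S′ z → Dec (Decomposes ω S′ z)
  decomposes? ω S′ z = transversalOn? (above ω) S′ ×-dec (σ z Fin.≟ ω)

  decomposition-unique : ∀ {ω S S′ z} → Decomposes ω S′ z → S ≡ S′ ∪ ⁅ z ⁆ → S′ ≡ S ↾ above ω
  decomposition-unique {ω} {S} {S′} {z} ((_ , confined , _) , σz≡ω) S≡S′∪z = ⊆-antisym
    (λ x∈S′ → ↾⁺ (subst (_ ∈_) (sym S≡S′∪z) (p⊆p∪q _ x∈S′)) (confined _ x∈S′))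
    (λ x∈ → let x∈S , σx∈above = ↾⁻ x∈ in
      [ id , (λ x∈z → ⊥-elim (ω∉above ω (subst (_∈ above ω) (trans (cong σ (x∈⁅y⁆⇒x≡y z x∈z)) σz≡ω) σx∈above))) ]′
      (x∈p∪q⁻ S′ _ (subst (_ ∈_) S≡S′∪z x∈S)))

  transversalOn-atLeast-count : ∀ ω S → χ (transversalOn? (atLeast ω) S) ≡
    ∑[ S′ ← allSubsets n ] ∑[ z ← allFin n ] χ (decomposes? ω S′ z) * χ (S ≟ˢ (S′ ∪ ⁅ z ⁆))
  transversalOn-atLeast-count ω S with transversalOn? (atLeast ω) S
  ... | no ¬trS = sym (∑-zero (allSubsets n) λ S′ → ∑-zero (allFin n) λ z →
                   χ*χ-exclusive (decomposes? ω S′ z) (S ≟ˢ (S′ ∪ ⁅ z ⁆)) λ (trS′ , σz≡ω) S≡ →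
                     ¬trS (subst (TransversalOn (atLeast ω)) (sym S≡) (transversalOn-join trS′ σz≡ω)))
  ... | yes trS with transversalOn-split trS
  ...   | z₀ , z₀∈S , σz₀≡ω , S≡ = sym (begin
    ∑[ S′ ← allSubsets n ] ∑[ z ← allFin n ] χ (decomposes? ω S′ z) * χ (S ≟ˢ (S′ ∪ ⁅ z ⁆))
      ≡⟨ ∑-supported _≟ˢ_ (allSubsets-enumerates n) S₀′ _ other-S′ ⟩
    ∑[ z ← allFin n ] χ (decomposes? ω S₀′ z) * χ (S ≟ˢ (S₀′ ∪ ⁅ z ⁆))
      ≡⟨ ∑-supported Fin._≟_ (allFin-enumerates n) z₀ _ other-z ⟩
    χ (decomposes? ω S₀′ z₀) * χ (S ≟ˢ (S₀′ ∪ ⁅ z₀ ⁆))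
      ≡⟨ cong₂ _*_ (χ-yes (decomposes? ω S₀′ z₀) (transversalOn-↾ trS above⊆atLeast , σz₀≡ω)) (χ-yes (S ≟ˢ _) S≡) ⟩
    1 ∎)
    where
    open ≡-Reasoning
    S₀′ = S ↾ above ω
    other-S′ : ∀ S′ → S′ ≢ S₀′ → ∑[ z ← allFin n ] χ (decomposes? ω S′ z) * χ (S ≟ˢ (S′ ∪ ⁅ z ⁆)) ≡ 0
    other-S′ S′ S′≢S₀′ = ∑-zero (allFin n) λ z →
      χ*χ-exclusive (decomposes? ω S′ z) (S ≟ˢ _) λ dec S≡ → S′≢S₀′ (decomposition-unique dec S≡)
    other-z : ∀ z → z ≢ z₀ → χ (decomposes? ω S₀′ z) * χ (S ≟ˢ (S₀′ ∪ ⁅ z ⁆)) ≡ 0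
    other-z z z≢z₀ = χ*χ-exclusive (decomposes? ω S₀′ z) (S ≟ˢ _) λ (_ , σz≡ω) S≡ →
      z≢z₀ (proj₁ trS z z₀ (subst (z ∈_) (sym S≡) (q⊆p∪q S₀′ _ (x∈⁅x⁆ z))) z₀∈S (trans σz≡ω (sym σz₀≡ω)))

  ∑-transversalOn-atLeast : ∀ ω (F : Subset n → ℕ) →
    ∑[ S ← allSubsets n ] χ (transversalOn? (atLeast ω) S) * F S ≡
    ∑[ S′ ← allSubsets n ] ∑[ z ← allFin n ] χ (decomposes? ω S′ z) * F (S′ ∪ ⁅ z ⁆)
  ∑-transversalOn-atLeast ω = ∑-reindex _≟ˢ_ (allSubsets-enumerates n) (allSubsets n) (allFin n)
    (λ S′ z → S′ ∪ ⁅ z ⁆) (λ S′ z → χ (decomposes? ω S′ z)) (χ ∘ transversalOn? (atLeast ω))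
    (transversalOn-atLeast-count ω)

module Invariance {n m : ℕ} (Z : Multimatroid n m) {_≺_ : Rel (Fin m) 0ℓ} (sto : IsStrictTotalOrder _≡_ _≺_) where

  open Rank Z
  open UpSets sto
  open Restriction (σ Z) sto

  private
    ρ : Subset n → ℕ
    ρ = r Z

  -- For a basis this is exactly activity of ω (active⇔spanned), but it makes sense for any transversal.
  Spanned : Subset n → Fin m → Set
  Spanned T ω = ∃ λ z → σ Z z ≡ ω × Spans (T ↾ above ω) z

  spanned? : ∀ T ω → Dec (Spanned T ω)
  spanned? T ω = any? λ z → (σ Z z Fin.≟ ω) ×-dec spans? (T ↾ above ω) z

  Agrees : Subset m → Subset n → Subset n → Set
  Agrees K R T = ∀ x → σ Z x ∈ K → ¬ Spanned R (σ Z x) → (x ∈ T → x ∈ R) × (x ∈ R → x ∈ T)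

  agrees? : ∀ K R T → Dec (Agrees K R T)
  agrees? K R T = all? λ x → (σ Z x ∈? K) →-dec ¬? (spanned? R (σ Z x)) →-dec
                             (((x ∈? T) →-dec (x ∈? R)) ×-dec ((x ∈? R) →-dec (x ∈? T)))

  agrees-↾ : ∀ {K K′ R T} → Agrees K R T → K′ ⊆ K → Agrees K′ R (T ↾ K′)
  agrees-↾ agree K′⊆K x σx∈K′ unspanned =
    (λ x∈T↾ → proj₁ (agree x (K′⊆K σx∈K′) unspanned) (↾-⊆ x∈T↾)) ,
    (λ x∈R → ↾⁺ (proj₂ (agree x (K′⊆K σx∈K′) unspanned) x∈R) σx∈K′)

  Outside : Subset m → Subset n → Set
  Outside K X = ∀ x → x ∈ X → σ Z x ∉ K

  ST-∪-outside : ∀ {K A X} → TransversalOn K A → ST X → Outside K X → ST (A ∪ X)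
  ST-∪-outside (stA , confined , _) stX out =
    ST-∪ stA stX (λ a x a∈A x∈X σa≡σx → out x x∈X (subst (_∈ _) σa≡σx (confined a a∈A)))

  SameIncrements : Subset m → Subset n → Subset n → Set
  SameIncrements K A B = ∀ X → ST X → Outside K X → (ρ (A ∪ X) , ρ A) ≋ (ρ (B ∪ X) , ρ B)

  sameIncrements-sym : ∀ {K A B} → SameIncrements K A B → SameIncrements K B A
  sameIncrements-sym same X stX out = ≋-sym (same X stX out)

  sameIncrements-trans : ∀ {K A B C} → SameIncrements K A B → SameIncrements K B C → SameIncrements K A C
  sameIncrements-trans same same′ X stX out = ≋-trans (same X stX out) (same′ X stX out)

  sameIncrements-mono : ∀ {K K′ A B} → K′ ⊆ K → SameIncrements K′ A B → SameIncrements K A B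
  sameIncrements-mono K′⊆K same X stX out = same X stX (λ x x∈X → out x x∈X ∘ K′⊆K)

  sameIncrements-spans : ∀ {K A B z} → SameIncrements K A B → σ Z z ∉ K → Spans A z → Spans B z
  sameIncrements-spans same σz∉K =
    ≋-cancel (same _ (ST-⁅⁆ _) (λ x x∈z → subst (_∉ _) (cong (σ Z) (sym (x∈⁅y⁆⇒x≡y _ x∈z))) σz∉K))

  module _ {ω : Fin m} where

    private
      ⁅⁆-outside-above : ∀ {z} → σ Z z ≡ ω → Outside (above ω) ⁅ z ⁆
      ⁅⁆-outside-above {z} σz≡ω x x∈z = subst (_∉ above ω) (sym (trans (cong (σ Z) (x∈⁅y⁆⇒x≡y z x∈z)) σz≡ω)) (ω∉above ω)

      avoids-outside : ∀ {X y} → Outside (atLeast ω) X → σ Z y ≡ ω → Avoids X y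
      avoids-outside out σy≡ω x x∈X σx≡σy = out x x∈X (subst (_∈ atLeast ω) (sym (trans σx≡σy σy≡ω)) (ω∈atLeast ω))


    sameIncrements-add-same : ∀ {A B z} → SameIncrements (above ω) A B → σ Z z ≡ ω →
                              SameIncrements (atLeast ω) (A ∪ ⁅ z ⁆) (B ∪ ⁅ z ⁆)
    sameIncrements-add-same {A} {B} {z} same σz≡ω X stX out
      rewrite ∪-assoc A ⁅ z ⁆ X | ∪-assoc B ⁅ z ⁆ X =
      ≋-rebase (same (⁅ z ⁆ ∪ X) stz∪X outz∪X) (same ⁅ z ⁆ (ST-⁅⁆ z) (⁅⁆-outside-above σz≡ω))
      where
      stz∪X : ST (⁅ z ⁆ ∪ X)
      stz∪X = ST-∪ (ST-⁅⁆ z) stX (λ x y x∈z y∈X σx≡σy → avoids-outside out σz≡ω y y∈X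
                                      (trans (sym σx≡σy) (cong (σ Z) (x∈⁅y⁆⇒x≡y z x∈z))))
      outz∪X : Outside (above ω) (⁅ z ⁆ ∪ X)
      outz∪X x x∈ = [ ⁅⁆-outside-above σz≡ω x , (λ x∈X → out x x∈X ∘ above⊆atLeast) ]′ (x∈p∪q⁻ ⁅ z ⁆ X x∈)

    sameIncrements-add-spanned : ∀ {A y z} → TransversalOn (above ω) A → Spans A y → σ Z y ≡ ω → σ Z z ≡ ω →
                                 SameIncrements (atLeast ω) (A ∪ ⁅ z ⁆) A
    sameIncrements-add-spanned {A} trA spans σy≡ω σz≡ω X stX out =
      r-increment-extend (ST-∪-outside trA stX (λ x x∈X → out x x∈X ∘ above⊆atLeast))
                         (avoids-above (proj₁ (proj₂ trA)) σy≡ω) (avoids-outside out σy≡ω) spans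
                         (trans σz≡ω (sym σy≡ω))

  module _ {R : Subset n} (trR : TransversalOn ⊤ R) where

    AgreementInvariant : Subset m → Set
    AgreementInvariant K = ∀ {T} → TransversalOn K T → Agrees K R T → SameIncrements K T (R ↾ K)

    -- Downwards over the classes: a class spanned in R is spanned in T as well, and adding any of its
    -- elements changes no increment; on any other class T and R add the same element.
    agreeing⇒sameIncrements : ∀ K → UpClosed K → AgreementInvariant K
    agreeing⇒sameIncrements = upClosed-induction AgreementInvariant base step
      where
      base : AgreementInvariant ∅
      base trT _ rewrite transversalOn-∅⇒≡∅ trT | transversalOn-∅⇒≡∅ (transversalOn-↾ {K′ = ∅} trR (λ _ → ∈⊤))
        = λ _ _ _ → ≋-refl
      step : ∀ ω → AgreementInvariant (above ω) → AgreementInvariant (atLeast ω)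
      step ω IH {T} trT agree with transversalOn-split trT | transversalOn-split (transversalOn-↾ trR (λ _ → ∈⊤))
      ... | z , z∈T , σz≡ω , T≡ | w , w∈R↾ , σw≡ω , R↾≡ =
        subst₂ (SameIncrements (atLeast ω)) (sym T≡) (sym (trans R↾≡ (cong (_∪ ⁅ w ⁆) (↾-↾ above⊆atLeast))))
               (joined (spanned? R ω))
        where
        trT′ = transversalOn-↾ trT above⊆atLeast
        trR′ = transversalOn-↾ trR (λ _ → ∈⊤)
        same′ : SameIncrements (above ω) (T ↾ above ω) (R ↾ above ω)
        same′ = IH trT′ (agrees-↾ agree above⊆atLeast)
        joined : Dec (Spanned R ω) → SameIncrements (atLeast ω) (T ↾ above ω ∪ ⁅ z ⁆) (R ↾ above ω ∪ ⁅ w ⁆)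
        joined (yes (y , σy≡ω , R′-spans-y)) =
          sameIncrements-trans (sameIncrements-add-spanned trT′ T′-spans-y σy≡ω σz≡ω)
            (sameIncrements-trans (sameIncrements-mono above⊆atLeast same′)
              (sameIncrements-sym (sameIncrements-add-spanned trR′ R′-spans-y σy≡ω σw≡ω)))
          where
          T′-spans-y = sameIncrements-spans (sameIncrements-sym same′) (subst (_∉ above ω) (sym σy≡ω) (ω∉above ω)) R′-spans-y
        joined (no unspanned) = subst (λ v → SameIncrements (atLeast ω) (T ↾ above ω ∪ ⁅ z ⁆) (R ↾ above ω ∪ ⁅ v ⁆))
                                      z≡w (sameIncrements-add-same same′ σz≡ω)
          where
          z∈R : z ∈ R
          z∈R = proj₁ (agree z (subst (_∈ atLeast ω) (sym σz≡ω) (ω∈atLeast ω)) (unspanned ∘ subst (Spanned R) σz≡ω)) z∈T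
          z≡w : z ≡ w
          z≡w = proj₁ trR z w z∈R (↾-⊆ w∈R↾) (trans σz≡ω (sym σw≡ω))

    spans-transfer : ∀ {ω T z} → TransversalOn (above ω) T → Agrees (above ω) R T → σ Z z ≡ ω →
                     (Spans T z → Spans (R ↾ above ω) z) × (Spans (R ↾ above ω) z → Spans T z)
    spans-transfer {ω} trT agree σz≡ω =
      sameIncrements-spans same σz∉ , sameIncrements-spans (sameIncrements-sym same) σz∉
      where
      same = agreeing⇒sameIncrements (above ω) (above-upClosed ω) trT agree
      σz∉ = subst (_∉ above ω) (sym σz≡ω) (ω∉above ω)

    spanned-invariant : ∀ {T} → TransversalOn ⊤ T → Agrees ⊤ R T →
                        ∀ ω → (Spanned T ω → Spanned R ω) × (Spanned R ω → Spanned T ω)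
    spanned-invariant {T} trT agree ω =
      (λ (z , σz≡ω , spans) → z , σz≡ω , proj₁ (transfer σz≡ω) spans) ,
      (λ (z , σz≡ω , spans) → z , σz≡ω , proj₂ (transfer σz≡ω) spans)
      where
      transfer : ∀ {z} → σ Z z ≡ ω →
                 (Spans (T ↾ above ω) z → Spans (R ↾ above ω) z) × (Spans (R ↾ above ω) z → Spans (T ↾ above ω) z)
      transfer = spans-transfer (transversalOn-↾ trT (λ _ → ∈⊤)) (agrees-↾ agree (λ _ → ∈⊤))

module Counting {n m : ℕ} (Z : Multimatroid n m) {_≺_ : Rel (Fin m) 0ℓ} (sto : IsStrictTotalOrder _≡_ _≺_) where

  open Rank Z
  open UpSets sto
  open Restriction (σ Z) sto
  open Invariance Z sto

  classWeight : ℕ → Fin m → ℕ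
  classWeight t ω = t + classSize (σ Z) ω ∸ 1

  module Weights (R : Subset n) where

    Allowed : Fin n → Set
    Allowed z = Spanned R (σ Z z) ⊎ z ∈ R

    allowed? : ∀ z → Dec (Allowed z)
    allowed? z = spanned? R (σ Z z) ⊎-dec (z ∈? R)

    weight : ℕ → Subset m → Subset n → ℕ
    weight t K S = χ (agrees? K R S) * t ^ nullity Z S

    activeProduct : ℕ → Subset m → ℕ
    activeProduct t K = ∏[ ω ← allFin m ] classWeight t ω ^ χ ((ω ∈? K) ×-dec spanned? R ω)

    classTerm : ℕ → Fin m → Fin n → ℕ
    classTerm t ω z = χ (σ Z z Fin.≟ ω) * (χ (allowed? z) * t ^ χ (spans? (R ↾ above ω) z))

  module _ {R : Subset n} (trR : TransversalOn ⊤ R) where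

    open Weights R

    module _ {ω S′ z} (trS′ : TransversalOn (above ω) S′) (σz≡ω : σ Z z ≡ ω) where

      private
        σz∉above : σ Z z ∉ above ω
        σz∉above = subst (_∉ above ω) (sym σz≡ω) (ω∉above ω)
        σz∈atLeast : σ Z z ∈ atLeast ω
        σz∈atLeast = subst (_∈ atLeast ω) (sym σz≡ω) (ω∈atLeast ω)
        x∈z⇒σx∉above : ∀ {x} → x ∈ ⁅ z ⁆ → σ Z x ∉ above ω
        x∈z⇒σx∉above x∈z = subst (_∉ above ω) (cong (σ Z) (sym (x∈⁅y⁆⇒x≡y z x∈z))) σz∉above

      agrees-join⁻ : Agrees (atLeast ω) R (S′ ∪ ⁅ z ⁆) → Agrees (above ω) R S′ × Allowed z
      agrees-join⁻ agree = agree′ , allowed (spanned? R (σ Z z))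
        where
        agree′ : Agrees (above ω) R S′
        agree′ x σx∈ unspanned =
          proj₁ (agree x (above⊆atLeast σx∈) unspanned) ∘ p⊆p∪q _ ,
          λ x∈R → [ id , (λ x∈z → ⊥-elim (x∈z⇒σx∉above x∈z σx∈)) ]′
                    (x∈p∪q⁻ S′ _ (proj₂ (agree x (above⊆atLeast σx∈) unspanned) x∈R))
        allowed : Dec (Spanned R (σ Z z)) → Allowed z
        allowed (yes spanned) = inj₁ spanned
        allowed (no unspanned) = inj₂ (proj₁ (agree z σz∈atLeast unspanned) (q⊆p∪q S′ _ (x∈⁅x⁆ z)))

      agrees-join⁺ : Agrees (above ω) R S′ → Allowed z → Agrees (atLeast ω) R (S′ ∪ ⁅ z ⁆)
      agrees-join⁺ agree allowed x σx∈ unspanned with atLeast-split σx∈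
      ... | inj₂ σx∈above =
        (λ x∈ → [ proj₁ (agree x σx∈above unspanned) , (λ x∈z → ⊥-elim (x∈z⇒σx∉above x∈z σx∈above)) ]′ (x∈p∪q⁻ S′ _ x∈)) ,
        p⊆p∪q _ ∘ proj₂ (agree x σx∈above unspanned)
      ... | inj₁ ω≡σx = x∈S′∪z⇒x∈R , x∈R⇒x∈S′∪z
        where
        σz≡σx = trans σz≡ω ω≡σx
        z∈R : z ∈ R
        z∈R = [ (λ spanned → ⊥-elim (unspanned (subst (Spanned R) σz≡σx spanned))) , id ]′ allowed
        x∈S′∪z⇒x∈R : x ∈ S′ ∪ ⁅ z ⁆ → x ∈ R
        x∈S′∪z⇒x∈R x∈ = [ (λ x∈S′ → ⊥-elim (ω∉above ω (subst (_∈ above ω) (sym ω≡σx) (proj₁ (proj₂ trS′) x x∈S′))))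
                         , (λ x∈z → subst (_∈ R) (sym (x∈⁅y⁆⇒x≡y z x∈z)) z∈R) ]′ (x∈p∪q⁻ S′ _ x∈)
        x∈R⇒x∈S′∪z : x ∈ R → x ∈ S′ ∪ ⁅ z ⁆
        x∈R⇒x∈S′∪z x∈R = q⊆p∪q S′ _ (subst (_∈ ⁅ z ⁆) (proj₁ trR z x z∈R x∈R σz≡σx) (x∈⁅x⁆ z))

      weight-join : ∀ t → weight t (atLeast ω) (S′ ∪ ⁅ z ⁆) ≡
                          (χ (allowed? z) * t ^ χ (spans? (R ↾ above ω) z)) * weight t (above ω) S′
      weight-join t with agrees? (above ω) R S′
      ... | no disagree = begin
        χ (agrees? (atLeast ω) R (S′ ∪ ⁅ z ⁆)) * t ^ nullity Z (S′ ∪ ⁅ z ⁆)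
          ≡⟨ cong (_* t ^ nullity Z (S′ ∪ ⁅ z ⁆)) (χ-no (agrees? _ R _) (disagree ∘ proj₁ ∘ agrees-join⁻)) ⟩
        0
          ≡⟨ *-zeroʳ (χ (allowed? z) * t ^ χ (spans? (R ↾ above ω) z)) ⟨
        (χ (allowed? z) * t ^ χ (spans? (R ↾ above ω) z)) * 0 ∎
        where open ≡-Reasoning
      ... | yes agree = begin
        χ (agrees? (atLeast ω) R (S′ ∪ ⁅ z ⁆)) * t ^ nullity Z (S′ ∪ ⁅ z ⁆)
          ≡⟨ cong₂ (λ a k → a * t ^ k)
               (χ-cong (agrees? _ R _) (allowed? z) (proj₂ ∘ agrees-join⁻) (agrees-join⁺ agree))
               (nullity-add (proj₁ trS′) (avoids-above (proj₁ (proj₂ trS′)) σz≡ω)) ⟩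
        χ (allowed? z) * t ^ (χ (spans? S′ z) + nullity Z S′)
          ≡⟨ cong (λ k → χ (allowed? z) * t ^ (k + nullity Z S′))
               (χ-cong (spans? S′ z) (spans? (R ↾ above ω) z) (proj₁ transfer) (proj₂ transfer)) ⟩
        χ (allowed? z) * t ^ (χ (spans? (R ↾ above ω) z) + nullity Z S′)
          ≡⟨ cong (χ (allowed? z) *_) (^-distribˡ-+-* t (χ (spans? (R ↾ above ω) z)) (nullity Z S′)) ⟩
        χ (allowed? z) * (t ^ χ (spans? (R ↾ above ω) z) * t ^ nullity Z S′)
          ≡⟨ *-assoc (χ (allowed? z)) (t ^ χ (spans? (R ↾ above ω) z)) (t ^ nullity Z S′) ⟨
        (χ (allowed? z) * t ^ χ (spans? (R ↾ above ω) z)) * t ^ nullity Z S′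
          ≡⟨ cong ((χ (allowed? z) * t ^ χ (spans? (R ↾ above ω) z)) *_) (*-identityˡ (t ^ nullity Z S′)) ⟨
        (χ (allowed? z) * t ^ χ (spans? (R ↾ above ω) z)) * (1 * t ^ nullity Z S′) ∎
        where
        open ≡-Reasoning
        transfer = spans-transfer trR trS′ agree σz≡ω

    spanned-element-unique : ∀ {ω y z} → σ Z y ≡ ω → σ Z z ≡ ω →
                             Spans (R ↾ above ω) y → Spans (R ↾ above ω) z → z ≡ y
    spanned-element-unique {y = y} {z} σy≡ω σz≡ω spans-y spans-z with z Fin.≟ y
    ... | yes z≡y = z≡y
    ... | no z≢y  = ⊥-elim (spans-unique (ST-⊆ ↾-⊆ (proj₁ trR)) z≢y (trans σz≡ω (sym σy≡ω))
                                         (↾above-avoids σz≡ω) spans-z spans-y)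

    ∑classTerm-spanned : ∀ t {ω y} → σ Z y ≡ ω → Spans (R ↾ above ω) y → ∑[ z ← allFin n ] classTerm t ω z ≡ classWeight t ω
    ∑classTerm-spanned t {ω} {y} σy≡ω spans-y = begin
      ∑[ z ← allFin n ] classTerm t ω z
        ≡⟨ ∑-cong (allFin n) only-y-spanned ⟩
      ∑[ z ← allFin n ] χ (σ Z z Fin.≟ ω) * t ^ χ (z Fin.≟ y)
        ≡⟨ m+n∸n≡m _ 1 ⟨
      (∑[ z ← allFin n ] χ (σ Z z Fin.≟ ω) * t ^ χ (z Fin.≟ y)) + 1 ∸ 1
        ≡⟨ cong (_∸ 1) (∑-reweight-one Fin._≟_ (allFin-enumerates n) (λ z → σ Z z Fin.≟ ω) σy≡ω t) ⟩
      t + (∑[ z ← allFin n ] χ (σ Z z Fin.≟ ω)) ∸ 1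
        ≡⟨ cong (λ k → t + k ∸ 1) (∣subset∣≡∑χ (λ z → σ Z z Fin.≟ ω)) ⟨
      classWeight t ω ∎
      where
      open ≡-Reasoning
      only-y-spanned : ∀ z → classTerm t ω z ≡ χ (σ Z z Fin.≟ ω) * t ^ χ (z Fin.≟ y)
      only-y-spanned z with σ Z z Fin.≟ ω
      ... | no _ = refl
      ... | yes σz≡ω = cong (1 *_) (begin
        χ (allowed? z) * t ^ χ (spans? (R ↾ above ω) z)
          ≡⟨ cong₂ (λ a k → a * t ^ k) (χ-yes (allowed? z) z-allowed)
                   (χ-cong (spans? _ z) (z Fin.≟ y) (spanned-element-unique σy≡ω σz≡ω spans-y) (λ { refl → spans-y })) ⟩
        1 * t ^ χ (z Fin.≟ y)
          ≡⟨ *-identityˡ _ ⟩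
        t ^ χ (z Fin.≟ y) ∎)
        where
        z-allowed : Allowed z
        z-allowed = inj₁ (y , trans σy≡ω (sym σz≡ω) , subst (λ ω → Spans (R ↾ above ω) y) (sym σz≡ω) spans-y)

    ∑classTerm-unspanned : ∀ t {ω} → ¬ Spanned R ω → ∑[ z ← allFin n ] classTerm t ω z ≡ 1
    ∑classTerm-unspanned t {ω} unspanned with proj₂ (proj₂ trR) ω ∈⊤
    ... | w , w∈R , σw≡ω = begin
      ∑[ z ← allFin n ] classTerm t ω z
        ≡⟨ ∑-supported Fin._≟_ (allFin-enumerates n) w _ only-w ⟩
      χ (σ Z w Fin.≟ ω) * (χ (allowed? w) * t ^ χ (spans? (R ↾ above ω) w))
        ≡⟨ cong₂ (λ a b → a * (b * t ^ χ (spans? (R ↾ above ω) w))) (χ-yes (σ Z w Fin.≟ ω) σw≡ω) (χ-yes (allowed? w) (inj₂ w∈R)) ⟩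
      1 * (1 * t ^ χ (spans? (R ↾ above ω) w))
        ≡⟨ cong (λ k → 1 * (1 * t ^ k)) (χ-no (spans? (R ↾ above ω) w) λ spans-w → unspanned (w , σw≡ω , spans-w)) ⟩
      1 ∎
      where
      open ≡-Reasoning
      only-w : ∀ z → z ≢ w → classTerm t ω z ≡ 0
      only-w z z≢w with σ Z z Fin.≟ ω | allowed? z
      ... | no _     | _ = refl
      ... | yes _    | no _ = *-zeroʳ 1
      ... | yes σz≡ω | yes (inj₁ spanned) = ⊥-elim (unspanned (subst (Spanned R) σz≡ω spanned))
      ... | yes σz≡ω | yes (inj₂ z∈R) = ⊥-elim (z≢w (proj₁ trR z w z∈R w∈R (trans σz≡ω (sym σw≡ω))))

    ∑classTerm : ∀ t ω → ∑[ z ← allFin n ] classTerm t ω z ≡ classWeight t ω ^ χ (spanned? R ω)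
    ∑classTerm t ω with spanned? R ω
    ... | yes (y , σy≡ω , spans-y) = trans (∑classTerm-spanned t σy≡ω spans-y) (sym (*-identityʳ _))
    ... | no unspanned             = ∑classTerm-unspanned t unspanned

    activeProduct-atLeast : ∀ t ω → activeProduct t (atLeast ω) ≡ classWeight t ω ^ χ (spanned? R ω) * activeProduct t (above ω)
    activeProduct-atLeast t ω = begin
      activeProduct t (atLeast ω)
        ≡⟨ ∏-cong (allFin m) split ⟩
      ∏[ ω′ ← allFin m ] (at ω′ * classWeight t ω′ ^ χ (in-above? ω′))
        ≡⟨ ∏-distrib-* (allFin m) at _ ⟩
      (∏[ ω′ ← allFin m ] at ω′) * activeProduct t (above ω)
        ≡⟨ cong (_* activeProduct t (above ω)) (∏-supported Fin._≟_ (allFin-enumerates m) ω at elsewhere) ⟩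
      at ω * activeProduct t (above ω)
        ≡⟨ cong (λ k → classWeight t ω ^ k * activeProduct t (above ω)) (χ-cong (is-ω? ω) (spanned? R ω) proj₂ (refl ,_)) ⟩
      classWeight t ω ^ χ (spanned? R ω) * activeProduct t (above ω) ∎
      where
      open ≡-Reasoning
      is-ω? : ∀ ω′ → Dec (ω′ ≡ ω × Spanned R ω′)
      in-above? : ∀ ω′ → Dec (ω′ ∈ above ω × Spanned R ω′)
      in-atLeast? : ∀ ω′ → Dec (ω′ ∈ atLeast ω × Spanned R ω′)
      is-ω? ω′ = (ω′ Fin.≟ ω) ×-dec spanned? R ω′
      in-above? ω′ = (ω′ ∈? above ω) ×-dec spanned? R ω′
      in-atLeast? ω′ = (ω′ ∈? atLeast ω) ×-dec spanned? R ω′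
      at : Fin m → ℕ
      at ω′ = classWeight t ω′ ^ χ (is-ω? ω′)
      elsewhere : ∀ ω′ → ω′ ≢ ω → at ω′ ≡ 1
      elsewhere ω′ ω′≢ω = cong (classWeight t ω′ ^_) (χ-no (is-ω? ω′) (ω′≢ω ∘ proj₁))
      exponent : ∀ ω′ → χ (in-atLeast? ω′) ≡ χ (is-ω? ω′) + χ (in-above? ω′)
      exponent ω′ = χ-⊎ (in-atLeast? ω′) (is-ω? ω′) (in-above? ω′)
        (λ (ω′∈ , s) → [ (λ ω≡ω′ → inj₁ (sym ω≡ω′ , s)) , (λ ω′∈above → inj₂ (ω′∈above , s)) ]′ (atLeast-split ω′∈))
        [ (λ { (refl , s) → ω∈atLeast ω , s }) , (λ (ω′∈ , s) → above⊆atLeast ω′∈ , s) ]′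
        (λ { (refl , _) (ω∈above , _) → ω∉above ω ω∈above })
      split : ∀ ω′ → classWeight t ω′ ^ χ (in-atLeast? ω′) ≡ at ω′ * classWeight t ω′ ^ χ (in-above? ω′)
      split ω′ = trans (cong (classWeight t ω′ ^_) (exponent ω′))
                       (^-distribˡ-+-* (classWeight t ω′) (χ (is-ω? ω′)) (χ (in-above? ω′)))

    decomposed-term : ∀ t ω S′ z → χ (decomposes? ω S′ z) * weight t (atLeast ω) (S′ ∪ ⁅ z ⁆) ≡
                                   classTerm t ω z * (χ (transversalOn? (above ω) S′) * weight t (above ω) S′)
    decomposed-term t ω S′ z with transversalOn? (above ω) S′ | σ Z z Fin.≟ ω
    ... | no _     | d        = sym (*-zeroʳ (χ d * (χ (allowed? z) * t ^ χ (spans? (R ↾ above ω) z))))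
    ... | yes _    | no _     = refl
    ... | yes trS′ | yes σz≡ω = begin
      1 * weight t (atLeast ω) (S′ ∪ ⁅ z ⁆)        ≡⟨ *-identityˡ _ ⟩
      weight t (atLeast ω) (S′ ∪ ⁅ z ⁆)            ≡⟨ weight-join trS′ σz≡ω t ⟩
      c * weight t (above ω) S′                    ≡⟨ cong₂ _*_ (*-identityˡ c) (*-identityˡ (weight t (above ω) S′)) ⟨
      (1 * c) * (1 * weight t (above ω) S′)        ∎
      where
      open ≡-Reasoning
      c = χ (allowed? z) * t ^ χ (spans? (R ↾ above ω) z)

    AgreeingSum : ℕ → Subset m → Set
    AgreeingSum t K = ∑[ S ← allSubsets n ] χ (transversalOn? K S) * weight t K S ≡ activeProduct t K

    agreeingSum-∅ : ∀ t → AgreeingSum t ∅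
    agreeingSum-∅ t = begin
      ∑[ S ← allSubsets n ] χ (transversalOn? ∅ S) * weight t ∅ S
        ≡⟨ ∑-supported _≟ˢ_ (allSubsets-enumerates n) ∅ _ (λ S S≢∅ →
             cong (_* weight t ∅ S) (χ-no (transversalOn? ∅ S) (S≢∅ ∘ transversalOn-∅⇒≡∅))) ⟩
      χ (transversalOn? ∅ ∅) * weight t ∅ ∅
        ≡⟨ cong₂ (λ a b → a * (b * t ^ nullity Z ∅)) (χ-yes (transversalOn? ∅ ∅) ∅-transversalOn-∅)
                 (χ-yes (agrees? ∅ R ∅) (λ _ σx∈∅ → ⊥-elim (∉⊥ σx∈∅))) ⟩
      1 * (1 * t ^ nullity Z ∅)
        ≡⟨ cong (λ k → 1 * (1 * t ^ k)) (trans (cong (_∸ r Z ∅) (∣⊥∣≡0 n)) (0∸n≡0 (r Z ∅))) ⟩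
      1
        ≡⟨ ∏-one (allFin m) (λ ω → cong (classWeight t ω ^_) (χ-no ((ω ∈? ∅) ×-dec _) (∉⊥ ∘ proj₁))) ⟨
      activeProduct t ∅ ∎
      where open ≡-Reasoning

    agreeingSum-step : ∀ t ω → AgreeingSum t (above ω) → AgreeingSum t (atLeast ω)
    agreeingSum-step t ω IH = begin
      ∑[ S ← allSubsets n ] χ (transversalOn? (atLeast ω) S) * weight t (atLeast ω) S
        ≡⟨ ∑-transversalOn-atLeast ω (weight t (atLeast ω)) ⟩
      ∑[ S′ ← allSubsets n ] ∑[ z ← allFin n ] χ (decomposes? ω S′ z) * weight t (atLeast ω) (S′ ∪ ⁅ z ⁆)
        ≡⟨ ∑-cong (allSubsets n) (λ S′ → trans (∑-cong (allFin n) (decomposed-term t ω S′))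
                                              (∑-distribʳ-* (allFin n) (classTerm t ω) (term S′))) ⟩
      ∑[ S′ ← allSubsets n ] c * term S′
        ≡⟨ ∑-distribˡ-* (allSubsets n) c term ⟩
      c * (∑[ S′ ← allSubsets n ] term S′)
        ≡⟨ cong₂ _*_ (∑classTerm t ω) IH ⟩
      classWeight t ω ^ χ (spanned? R ω) * activeProduct t (above ω)
        ≡⟨ activeProduct-atLeast t ω ⟨
      activeProduct t (atLeast ω) ∎
      where
      open ≡-Reasoning
      c = ∑[ z ← allFin n ] classTerm t ω z
      term : Subset n → ℕ
      term S′ = χ (transversalOn? (above ω) S′) * weight t (above ω) S′

    agreeing-sum : ∀ t K → UpClosed K → AgreeingSum t K
    agreeing-sum t = upClosed-induction (AgreeingSum t) (agreeingSum-∅ t) (agreeingSum-step t)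

module BasisTheory {n m : ℕ} (Z : Multimatroid n m) where

  open Rank Z

  independent⇒nullity≡0 : ∀ {X} → Independent X → nullity Z X ≡ 0
  independent⇒nullity≡0 {X} indX = trans (cong (∣ X ∣ ∸_) indX) (n∸n≡0 ∣ X ∣)

  nullity≡0⇒independent : ∀ {X} → ST X → nullity Z X ≡ 0 → Independent X
  nullity≡0⇒independent stX n≡0 = ≤-antisym (r≤∣∣ stX) (m∸n≡0⇒m≤n n≡0)

  independent⇒¬dependent : ∀ {X} → Independent X → ¬ (0 < nullity Z X)
  independent⇒¬dependent indX = <-irrefl (sym (independent⇒nullity≡0 indX))

  circuit-within : ∀ {X} → ST X → 0 < nullity Z X → ∃ λ C → C ⊆ X × IsCircuit Z C
  circuit-within {X} = go X (<-wellFounded ∣ X ∣)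
    where
    go : ∀ X → Acc _<_ ∣ X ∣ → ST X → 0 < nullity Z X → ∃ λ C → C ⊆ X × IsCircuit Z C
    go X (acc smaller) stX dependent with anySubset? (λ D → (D ⊂? X) ×-dec (0 ℕ.<? nullity Z D))
    ... | no minimal = X , id , stX , dependent , minimal
    ... | yes (D , D⊂X , dependent-D) =
      let C , C⊆D , circuit = go D (smaller (p⊂q⇒∣p∣<∣q∣ D⊂X)) (ST-⊆ (proj₁ D⊂X) stX) dependent-D
      in C , proj₁ D⊂X ∘ C⊆D , circuit

  skew-partner : NonDegenerate Z → ∀ x → ∃ λ y → σ Z y ≡ σ Z x × y ≢ x
  skew-partner nondeg x with any? (λ y → (σ Z y Fin.≟ σ Z x) ×-dec ¬? (y Fin.≟ x))
  ... | yes partner = partner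
  ... | no alone = ⊥-elim (<-irrefl refl (begin-strict
    1                                            <⟨ nondeg (σ Z x) ⟩
    classSize (σ Z) (σ Z x)                      ≡⟨ ∣subset∣≡∑χ (λ z → σ Z z Fin.≟ σ Z x) ⟩
    ∑[ z ← allFin n ] χ (σ Z z Fin.≟ σ Z x)      ≡⟨ ∑-supported Fin._≟_ (allFin-enumerates n) x _ (λ z z≢x →
                                                      χ-no (σ Z z Fin.≟ σ Z x) (λ σz≡σx → alone (z , σz≡σx , z≢x))) ⟩
    χ (σ Z x Fin.≟ σ Z x)                        ≡⟨ χ-yes (σ Z x Fin.≟ σ Z x) refl ⟩
    1                                            ∎))
    where open ≤-Reasoning

  basis⇐ : ∀ {B} → IsTransversal (σ Z) B → Independent B → IsBasis Z B
  basis⇐ {B} (stB , covers) indB = stB , independent⇒nullity≡0 indB , maximal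
    where
    maximal : ∀ S → ST S → B ⊆ S → nullity Z S ≡ 0 → S ⊆ B
    maximal S stS B⊆S _ {x} x∈S = let y , y∈B , σy≡σx = covers (σ Z x) in
      subst (_∈ B) (stS y x (B⊆S y∈B) x∈S σy≡σx) y∈B

  maximal⇒spans : ∀ {B z} → IsBasis Z B → Avoids B z → Spans B z
  maximal⇒spans {B} {z} (stB , n≡0 , maximal) avoids with spans? B z
  ... | yes spans = spans
  ... | no ¬spans = ⊥-elim (Avoids⇒∉ avoids (maximal (B ∪ ⁅ z ⁆) stB∪z (p⊆p∪q _) (independent⇒nullity≡0 indB∪z)
                                                      (q⊆p∪q B _ (x∈⁅x⁆ z))))
    where
    stB∪z = ST-add stB avoids
    indB∪z = independent-add stB avoids (nullity≡0⇒independent stB n≡0) ¬spans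

  basis⇒ : NonDegenerate Z → ∀ {B} → IsBasis Z B → IsTransversal (σ Z) B × Independent B
  basis⇒ nondeg {B} basis@(stB , n≡0 , _) = (stB , covers) , nullity≡0⇒independent stB n≡0
    where
    covers : ∀ ω → ∃ λ x → x ∈ B × σ Z x ≡ ω
    covers ω with any? (λ x → (x ∈? B) ×-dec (σ Z x Fin.≟ ω))
    ... | yes met = met
    ... | no unmet with σ-surj Z ω
    ...   | x , σx≡ω with skew-partner nondeg x
    ...     | y , σy≡σx , y≢x = ⊥-elim (spans-unique stB y≢x σy≡σx (avoids σy≡σx)
                                   (maximal⇒spans basis (avoids σy≡σx)) (maximal⇒spans basis (avoids refl)))
      where
      avoids : ∀ {v} → σ Z v ≡ σ Z x → Avoids B v
      avoids σv≡σx b b∈B σb≡σv = unmet (b , b∈B , trans σb≡σv (trans σv≡σx σx≡ω))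

module Activity {n m : ℕ} (Z : Multimatroid n m) {_≺_ : Rel (Fin m) 0ℓ} (sto : IsStrictTotalOrder _≡_ _≺_) where

  open Rank Z
  open UpSets sto
  open Restriction (σ Z) sto
  open Invariance Z sto
  open BasisTheory Z
  open IsStrictTotalOrder sto using () renaming (irrefl to ≺-irrefl)

  module _ {B : Subset n} (trB : TransversalOn ⊤ B) (indB : Independent B) {ω : Fin m} where

    private
      B′ : Subset n
      B′ = B ↾ above ω
      stB′ : ST B′
      stB′ = ST-⊆ ↾-⊆ (proj₁ trB)
      indB′ : Independent B′
      indB′ = independent-⊆ ↾-⊆ (proj₁ trB) indB
      avoids : ∀ {z} → σ Z z ≡ ω → Avoids B′ z
      avoids = ↾above-avoids

    spanned⇒active : Spanned B ω → Active Z _≺_ B ω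
    spanned⇒active (z , σz≡ω , spans) with circuit-within (ST-add stB′ (avoids σz≡ω)) dependent
      where
      dependent : 0 < nullity Z (B′ ∪ ⁅ z ⁆)
      dependent = subst (0 <_) (sym (trans (nullity-add stB′ (avoids σz≡ω))
                                           (cong₂ _+_ (χ-yes (spans? B′ z) spans) (independent⇒nullity≡0 indB′))))
                        (s≤s z≤n)
    ... | C , C⊆B′∪z , circuit = C , circuit , C⊆B∪ω , z , z∈C (z ∈? C) , σz≡ω , least
      where
      z∈C : Dec (z ∈ C) → z ∈ C
      z∈C (yes z∈C) = z∈C
      z∈C (no z∉C) = ⊥-elim (independent⇒¬dependent (independent-⊆ C⊆B′ stB′ indB′) (proj₁ (proj₂ circuit)))
        where
        C⊆B′ : C ⊆ B′
        C⊆B′ x∈C = [ id , (λ x∈z → ⊥-elim (z∉C (subst (_∈ C) (x∈⁅y⁆⇒x≡y z x∈z) x∈C))) ]′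
                     (x∈p∪q⁻ B′ _ (C⊆B′∪z x∈C))
      C⊆B∪ω : C ⊆ B ∪ classOf (σ Z) ω
      C⊆B∪ω x∈C = [ p⊆p∪q _ ∘ ↾-⊆
                  , (λ x∈z → q⊆p∪q B _ (∈-subset⁺ (λ x → σ Z x Fin.≟ ω) (trans (cong (σ Z) (x∈⁅y⁆⇒x≡y z x∈z)) σz≡ω))) ]′
                  (x∈p∪q⁻ B′ _ (C⊆B′∪z x∈C))
      least : ∀ y → y ∈ C → y ≢ z → ω ≺ σ Z y
      least y y∈C y≢z = [ ∈-subset⁻ _ ∘ proj₂ ∘ ↾⁻ , (λ y∈z → ⊥-elim (y≢z (x∈⁅y⁆⇒x≡y z y∈z))) ]′
                          (x∈p∪q⁻ B′ _ (C⊆B′∪z y∈C))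

    active⇒spanned : Active Z _≺_ B ω → Spanned B ω
    active⇒spanned (C , circuit , C⊆B∪ω , x , x∈C , σx≡ω , least) = x , σx≡ω , spans (spans? B′ x)
      where
      C⊆B′∪x : C ⊆ B′ ∪ ⁅ x ⁆
      C⊆B′∪x {y} y∈C with y Fin.≟ x
      ... | yes refl = q⊆p∪q B′ _ (x∈⁅x⁆ y)
      ... | no y≢x = p⊆p∪q _ (↾⁺ y∈B (∈-subset⁺ _ ω≺σy))
        where
        ω≺σy = least y y∈C y≢x
        y∈B : y ∈ B
        y∈B = [ id , (λ y∈ω → ⊥-elim (≺-irrefl (sym (∈-subset⁻ (λ x → σ Z x Fin.≟ ω) y∈ω)) ω≺σy)) ]′
                (x∈p∪q⁻ B _ (C⊆B∪ω y∈C))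
      spans : Dec (Spans B′ x) → Spans B′ x
      spans (yes spans) = spans
      spans (no ¬spans) = ⊥-elim (independent⇒¬dependent
        (independent-⊆ C⊆B′∪x (ST-add stB′ (avoids σx≡ω)) (independent-add stB′ (avoids σx≡ω) indB′ ¬spans))
        (proj₁ (proj₂ circuit)))

  unspanned⇒independent : ∀ {T} → TransversalOn ⊤ T → (∀ x → x ∈ T → ¬ Spans (T ↾ above (σ Z x)) x) → Independent T
  unspanned⇒independent {T} trT unspanned =
    subst Independent (↾-idem trT) (upClosed-induction (Independent ∘ (T ↾_)) base step ⊤ ⊤-upClosed)
    where
    base : Independent (T ↾ ∅)
    base rewrite transversalOn-∅⇒≡∅ (transversalOn-↾ {K′ = ∅} trT (λ _ → ∈⊤)) =
      trans (n≤0⇒n≡0 (≤-trans (r≤∣∣ ST-∅) (≤-reflexive (∣⊥∣≡0 n)))) (sym (∣⊥∣≡0 n))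
    step : ∀ ω → Independent (T ↾ above ω) → Independent (T ↾ atLeast ω)
    step ω indT′ with transversalOn-split (transversalOn-↾ {K′ = atLeast ω} trT (λ _ → ∈⊤))
    ... | z , z∈ , σz≡ω , T↾≡ = subst Independent (sym (trans T↾≡ (cong (_∪ ⁅ z ⁆) (↾-↾ above⊆atLeast))))
      (independent-add (ST-⊆ ↾-⊆ (proj₁ trT)) (↾above-avoids σz≡ω) indT′
                       (subst (λ ω → ¬ Spans (T ↾ above ω) z) σz≡ω (unspanned z (↾-⊆ z∈))))

  -- In every class keep the element of S unless the part of S above the class spans it; then take
  -- a skew partner instead, which (R2) keeps unspanned.
  module BasisFrom (nondeg : NonDegenerate Z) {S : Subset n} (trS : TransversalOn ⊤ S) where

    private
      element : Fin m → Fin n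
      element ω = proj₁ (proj₂ (proj₂ trS) ω ∈⊤)
      element∈S : ∀ ω → element ω ∈ S
      element∈S ω = proj₁ (proj₂ (proj₂ (proj₂ trS) ω ∈⊤))
      σ-element : ∀ ω → σ Z (element ω) ≡ ω
      σ-element ω = proj₂ (proj₂ (proj₂ (proj₂ trS) ω ∈⊤))
      element-unique : ∀ {x} → x ∈ S → x ≡ element (σ Z x)
      element-unique {x} x∈S = proj₁ trS x _ x∈S (element∈S (σ Z x)) (sym (σ-element (σ Z x)))

      choose : ∀ ω → Dec (Spans (S ↾ above ω) (element ω)) → Fin n
      choose ω (yes _) = proj₁ (skew-partner nondeg (element ω))
      choose ω (no _)  = element ω

    pick : Fin m → Fin n
    pick ω = choose ω (spans? _ _)

    σ-pick : ∀ ω → σ Z (pick ω) ≡ ω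
    σ-pick ω with spans? (S ↾ above ω) (element ω)
    ... | yes _ = trans (proj₁ (proj₂ (skew-partner nondeg (element ω)))) (σ-element ω)
    ... | no _  = σ-element ω

    pick-unspanned : ∀ ω → ¬ Spans (S ↾ above ω) (pick ω)
    pick-unspanned ω with spans? (S ↾ above ω) (element ω)
    ... | no ¬spans = ¬spans
    ... | yes spans = λ spans-partner → spans-unique (ST-⊆ ↾-⊆ (proj₁ trS)) partner≢element
        σ-partner (↾above-avoids σ-partner-ω) spans-partner spans
      where
      σ-partner = proj₁ (proj₂ (skew-partner nondeg (element ω)))
      σ-partner-ω = trans σ-partner (σ-element ω)
      partner≢element = proj₂ (proj₂ (skew-partner nondeg (element ω)))

    pick≡element : ∀ ω → ¬ Spanned S ω → pick ω ≡ element ω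
    pick≡element ω unspanned with spans? (S ↾ above ω) (element ω)
    ... | yes spans = ⊥-elim (unspanned (element ω , σ-element ω , spans))
    ... | no _      = refl

    B : Subset n
    B = subset (λ x → x Fin.≟ pick (σ Z x))

    trB : TransversalOn ⊤ B
    trB = (λ x y x∈B y∈B σx≡σy → trans (picked x∈B) (trans (cong pick σx≡σy) (sym (picked y∈B)))) ,
          (λ _ _ → ∈⊤) ,
          (λ ω _ → pick ω , ∈-subset⁺ _ (cong pick (sym (σ-pick ω))) , σ-pick ω)
      where
      picked : ∀ {x} → x ∈ B → x ≡ pick (σ Z x)
      picked = ∈-subset⁻ _

    S-agrees : Agrees ⊤ S B
    S-agrees x _ unspanned =
      (λ x∈B → subst (_∈ S) (sym (trans (∈-subset⁻ _ x∈B) (pick≡element (σ Z x) unspanned))) (element∈S (σ Z x))) ,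
      (λ x∈S → ∈-subset⁺ _ (trans (element-unique x∈S) (sym (pick≡element (σ Z x) unspanned))))

    basis : IsBasis Z B
    basis = basis⇐ (transversalOn-⊤⇒transversal trB) (unspanned⇒independent trB unspanned)
      where
      unspanned : ∀ x → x ∈ B → ¬ Spans (B ↾ above (σ Z x)) x
      unspanned x x∈B spans = pick-unspanned (σ Z x) (subst (Spans (S ↾ above (σ Z x))) (∈-subset⁻ _ x∈B)
        (proj₁ (spans-transfer trS (transversalOn-↾ trB (λ _ → ∈⊤)) (agrees-↾ S-agrees (λ _ → ∈⊤)) refl) spans))

  module _ (nondeg : NonDegenerate Z) where

    basis⇒transversalOn : ∀ {R} → IsBasis Z R → TransversalOn ⊤ R
    basis⇒transversalOn = transversal⇒transversalOn-⊤ ∘ proj₁ ∘ basis⇒ nondeg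

    active⇔spanned : ∀ {R} → IsBasis Z R → ∀ ω → (Active Z _≺_ R ω → Spanned R ω) × (Spanned R ω → Active Z _≺_ R ω)
    active⇔spanned basisR ω = active⇒spanned trR indR , spanned⇒active trR indR
      where
      trR = basis⇒transversalOn basisR
      indR = proj₂ (basis⇒ nondeg basisR)

    agreeing-bases-similar : ∀ {R₁ R₂ S} → IsBasis Z R₁ → IsBasis Z R₂ → TransversalOn ⊤ S →
                             Agrees ⊤ R₁ S → Agrees ⊤ R₂ S → _~_ Z _≺_ R₁ R₂
    agreeing-bases-similar {R₁} {R₂} {S} basis₁ basis₂ trS agree₁ agree₂ = same-activity , same-inactive
      where
      spanned₁ = spanned-invariant (basis⇒transversalOn basis₁) trS agree₁
      spanned₂ = spanned-invariant (basis⇒transversalOn basis₂) trS agree₂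
      same-activity : ∀ ω → (Active Z _≺_ R₁ ω → Active Z _≺_ R₂ ω) × (Active Z _≺_ R₂ ω → Active Z _≺_ R₁ ω)
      same-activity ω =
        proj₂ (active⇔spanned basis₂ ω) ∘ proj₁ (spanned₂ ω) ∘ proj₂ (spanned₁ ω) ∘ proj₁ (active⇔spanned basis₁ ω) ,
        proj₂ (active⇔spanned basis₁ ω) ∘ proj₁ (spanned₁ ω) ∘ proj₂ (spanned₂ ω) ∘ proj₁ (active⇔spanned basis₂ ω)
      same-inactive : ∀ ω → ¬ Active Z _≺_ R₁ ω → ∀ x → σ Z x ≡ ω → (x ∈ R₁ → x ∈ R₂) × (x ∈ R₂ → x ∈ R₁)
      same-inactive ω inactive x refl =
        proj₁ (agree₂ x ∈⊤ unspanned₂) ∘ proj₂ (agree₁ x ∈⊤ unspanned₁) ,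
        proj₁ (agree₁ x ∈⊤ unspanned₁) ∘ proj₂ (agree₂ x ∈⊤ unspanned₂)
        where
        unspanned₁ = inactive ∘ proj₂ (active⇔spanned basis₁ ω)
        unspanned₂ = unspanned₁ ∘ proj₁ (spanned₁ ω) ∘ proj₂ (spanned₂ ω)

    similar⇒agrees : ∀ {S R} (trS : TransversalOn ⊤ S) → IsBasis Z R →
                     _~_ Z _≺_ (BasisFrom.B nondeg trS) R → Agrees ⊤ R S
    similar⇒agrees {S} {R} trS basisR (same-activity , same-inactive) x _ unspanned-R =
      proj₁ (B-R x refl) ∘ proj₂ (S-agrees x ∈⊤ unspanned-S) ,
      proj₁ (S-agrees x ∈⊤ unspanned-S) ∘ proj₂ (B-R x refl)
      where
      open BasisFrom nondeg trS
      inactive-B : ¬ Active Z _≺_ B (σ Z x)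
      inactive-B = unspanned-R ∘ proj₁ (active⇔spanned basisR (σ Z x)) ∘ proj₁ (same-activity (σ Z x))
      B-R = same-inactive (σ Z x) inactive-B
      unspanned-S = inactive-B ∘ proj₂ (active⇔spanned basis (σ Z x)) ∘ proj₂ (spanned-invariant trS trB S-agrees (σ Z x))

    exactly-one-agreeing : ∀ {Rs S} → IsRepSystem Z _≺_ Rs → TransversalOn ⊤ S → ∑[ R ← Rs ] χ (agrees? ⊤ R S) ≡ 1
    exactly-one-agreeing {Rs} {S} (bases , complete , distinct) trS =
      ∑-exactly-one (λ R → agrees? ⊤ R S) bases
        (Any.map (λ B~R basisR → similar⇒agrees trS basisR B~R) (complete _ (BasisFrom.basis nondeg trS)))
        (AllPairs.map (λ ≁ basis₁ basis₂ agree₁ agree₂ → ≁ (agreeing-bases-similar basis₁ basis₂ trS agree₁ agree₂)) distinct)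

module Expansion {n m : ℕ} (Z : Multimatroid n m) {_≺_ : Rel (Fin m) 0ℓ} (sto : IsStrictTotalOrder _≡_ _≺_) where

  open Restriction (σ Z) sto
  open Invariance Z sto
  open Counting Z sto
  open Weights
  open Activity Z sto

  transitionPoly≡∑ : ∀ t → transitionPoly Z t ≡ ∑[ T ← allSubsets n ] χ (transversalOn? ⊤ T) * t ^ nullity Z T
  transitionPoly≡∑ t = trans (∑-filter (transversal? (σ Z)) (λ T → t ^ nullity Z T) (allSubsets n))
    (∑-cong (allSubsets n) λ T → cong (_* t ^ nullity Z T)
      (χ-cong (transversal? (σ Z) T) (transversalOn? ⊤ T) transversal⇒transversalOn-⊤ transversalOn-⊤⇒transversal))

  module _ (nondeg : NonDegenerate Z) where

    activityWeight≡activeProduct : ∀ {R} → IsBasis Z R → ∀ t → activityWeight Z sto t R ≡ activeProduct R t ⊤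
    activityWeight≡activeProduct {R} basisR t = trans (∏-filter (active? Z sto R) (classWeight t) (allFin m))
      (∏-cong (allFin m) λ ω → cong (classWeight t ω ^_)
        (χ-cong (active? Z sto R ω) ((ω ∈? ⊤) ×-dec spanned? R ω)
                (λ active → ∈⊤ , proj₁ (active⇔spanned nondeg basisR ω) active)
                (proj₂ (active⇔spanned nondeg basisR ω) ∘′ proj₂)))

    split-by-representative : ∀ {Rs} → IsRepSystem Z _≺_ Rs → ∀ t T →
      χ (transversalOn? ⊤ T) * t ^ nullity Z T ≡ ∑[ R ← Rs ] χ (transversalOn? ⊤ T) * weight R t ⊤ T
    split-by-representative {Rs} rep t T =
      trans (cases (transversalOn? ⊤ T)) (sym (∑-distribˡ-* Rs (χ (transversalOn? ⊤ T)) (λ R → weight R t ⊤ T)))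
      where
      open ≡-Reasoning
      cases : (d : Dec (TransversalOn ⊤ T)) → χ d * t ^ nullity Z T ≡ χ d * (∑[ R ← Rs ] weight R t ⊤ T)
      cases (no _) = refl
      cases (yes trT) = cong (1 *_) (begin
        t ^ nullity Z T                                   ≡⟨ *-identityʳ (t ^ nullity Z T) ⟨
        t ^ nullity Z T * 1                               ≡⟨ cong (t ^ nullity Z T *_) (exactly-one-agreeing nondeg rep trT) ⟨
        t ^ nullity Z T * (∑[ R ← Rs ] χ (agrees? ⊤ R T)) ≡⟨ ∑-distribˡ-* Rs (t ^ nullity Z T) (λ R → χ (agrees? ⊤ R T)) ⟨
        ∑[ R ← Rs ] t ^ nullity Z T * χ (agrees? ⊤ R T)   ≡⟨ ∑-cong Rs (λ R → *-comm (t ^ nullity Z T) (χ (agrees? ⊤ R T))) ⟩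
        ∑[ R ← Rs ] weight R t ⊤ T                        ∎)

corollary3p19 : ∀ {n m : ℕ} (Z : Multimatroid n m) → NonDegenerate Z →
    (_≺_ : Rel (Fin m) 0ℓ) (sto : IsStrictTotalOrder _≡_ _≺_) →
    (Rs : List (Subset n)) → IsRepSystem Z _≺_ Rs →
    (t : ℕ) → transitionPoly Z t ≡ sum (map (activityWeight Z sto t) Rs)
corollary3p19 {n} Z nondeg _≺_ sto Rs rep@(bases , _ , _) t = begin
  transitionPoly Z t
    ≡⟨ transitionPoly≡∑ t ⟩
  ∑[ T ← allSubsets n ] χ (transversalOn? ⊤ T) * t ^ nullity Z T
    ≡⟨ ∑-cong (allSubsets n) (split-by-representative nondeg rep t) ⟩
  ∑[ T ← allSubsets n ] ∑[ R ← Rs ] χ (transversalOn? ⊤ T) * weight R t ⊤ T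
    ≡⟨ ∑-comm (allSubsets n) Rs _ ⟩
  ∑[ R ← Rs ] ∑[ T ← allSubsets n ] χ (transversalOn? ⊤ T) * weight R t ⊤ T
    ≡⟨ ∑-cong-All bases (λ basisR → agreeing-sum (basis⇒transversalOn nondeg basisR) t ⊤ ⊤-upClosed) ⟩
  ∑[ R ← Rs ] activeProduct R t ⊤
    ≡⟨ ∑-cong-All bases (λ basisR → activityWeight≡activeProduct nondeg basisR t) ⟨
  sum (map (activityWeight Z sto t) Rs) ∎
  where
  open ≡-Reasoning
  open UpSets sto
  open Restriction (σ Z) sto
  open Counting Z sto
  open Weights
  open Activity Z sto
  open Expansion Z sto
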